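{- Let $m\geq 4$ and let $G=\Theta(s_1^{m-1},s_2)$ be the generalized theta graph with $m-1$ paths having $s_1$ internal vertices and one path having $s_2$ internal vertices, where $s_2>s_1$. Then $\beta(G)=m$ if $G=\Theta(1^{m-1},3)$ (i.e. $s_1=1,s_2=3$) or $G=\Theta(2^3,4)$ (i.e. $m=4$, $s_1=2$, $s_2=4$), and $\beta(G)=m-1$ otherwise.
   Context: Graphs are simple, connected, finite. A set $W\subseteq V(G)$ is resolving if for any distinct $u,v$ there is $w\in W$ with $d(u,w)\ne d(v,w)$; $\beta(G)$ is the minimum size of a resolving set. A generalized theta graph consists of two vertices $c_1,c_2$ (centers) joined by internally disjoint paths; a path with $s$ internal vertices has length $s+1$. -}

module Defs where

open import Data.Nat using (ℕ; zero; suc; _≤_)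
open import Data.Fin using (Fin; toℕ)
import Data.Fin as F
open import Data.List using (List; length)
open import Data.List.Membership.Propositional using (_∈_)
open import Data.List.Relation.Unary.Unique.Propositional using (Unique)
open import Data.Product using (Σ; _×_; ∃-syntax)
open import Data.Sum using (_⊎_)
open import Relation.Binary.PropositionalEquality using (_≡_; _≢_)

module GraphNotions {V : Set} (Adj : V → V → Set) where

  data Walk : V → V → ℕ → Set where
    here : ∀ {u} → Walk u u 0
    _∷_  : ∀ {u v w k} → Adj u v → Walk v w k → Walk u w (suc k)

  Dist : V → V → ℕ → Set
  Dist u v k = Walk u v k × (∀ k' → Walk u v k' → k ≤ k')

  Resolving : List V → Set
  Resolving W = ∀ u v → u ≢ v →
    ∃[ w ] (w ∈ W × (∀ a b → Dist u w a → Dist v w b → a ≢ b))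

  MetricDim : ℕ → Set
  MetricDim k =
    (∃[ W ] (Unique W × length W ≡ k × Resolving W)) ×
    (∀ W → Unique W → Resolving W → k ≤ length W)

module Theta (m : ℕ) (s : Fin m → ℕ) where

  data Vertex : Set where
    c₁ c₂ : Vertex
    inner : (i : Fin m) → Fin (s i) → Vertex

  -- directed edges along each path c₁ — inner i 0 — … — inner i (s i - 1) — c₂
  data Edge : Vertex → Vertex → Set where
    start  : ∀ i (j : Fin (s i)) → toℕ j ≡ 0 → Edge c₁ (inner i j)
    step   : ∀ i (j k : Fin (s i)) → toℕ k ≡ suc (toℕ j) → Edge (inner i j) (inner i k)
    end    : ∀ i (j : Fin (s i)) → suc (toℕ j) ≡ s i → Edge (inner i j) c₂
    direct : ∀ i → s i ≡ 0 → Edge c₁ c₂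

  Adj : Vertex → Vertex → Set
  Adj u v = Edge u v ⊎ Edge v u

  open GraphNotions Adj public

thetaLengths : (m s₁ s₂ : ℕ) → Fin m → ℕ
thetaLengths m s₁ s₂ F.zero    = s₂
thetaLengths m s₁ s₂ (F.suc _) = s₁

ThetaMetricDim : (m s₁ s₂ k : ℕ) → Set
ThetaMetricDim m s₁ s₂ k = Theta.MetricDim m (thetaLengths m s₁ s₂) k

module Submission where

-- Write d₁ x and d₂ x for the distances from x to the two centres. In a theta graph the distance
-- between two vertices is the least of the distance along a common path and the two detours
-- d₁ x + d₁ y and d₂ x + d₂ y through a centre; the formula is checked by exhibiting walks and
-- showing it changes by at most one along every edge.
--
-- Lower bound m - 1: the first vertices of two short paths without landmarks are at equal distance
-- from every other vertex, so at most one short path is landmark-free; if one is, its first vertex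
-- and the first vertex of the long path are only separated by a landmark off the short paths.
--
-- Upper bound m - 1: the first vertices of all short paths but one, together with the first
-- vertex of the long path (or its third vertex when s₂ = s₁ + 2, s₁ ≥ 3), resolve the graph,
-- except for Θ(1^{m-1}, 3) and Θ(2^3, 4). For Θ(2^{m-1}, 4) with m ≥ 5 a different configuration
-- works; for Θ(1^{m-1}, 3) a landmark-free short path still forces a second extra landmark, and
-- Θ(2^3, 4) is settled by checking all 3-sets.

open import Defs
open import Data.Nat using (ℕ; zero; suc; _+_; _∸_; _≤_; _<_; _⊓_; ∣_-_∣; _≤?_; _≡ᵇ_; z≤n; s≤s)
open import Data.Nat.Properties
open import Data.Nat.Tactic.RingSolver using (solve-∀)
open import Data.Bool using (Bool; not; _∧_; T)
open import Data.Bool.ListAction using (all; any)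
open import Data.Bool.Properties using (T-∧)
open import Data.Unit using (tt)
open import Data.Fin using (Fin; toℕ; fromℕ<)
import Data.Fin as F
import Data.Fin.Properties as FP
open import Data.Maybe using (Maybe; just; nothing)
open import Data.List using (List; []; _∷_; length; allFin; map; _++_)
open import Data.List.Properties using (length-++; length-map; length-tabulate)
open import Data.List.Membership.Propositional using (_∈_; _∉_)
open import Data.List.Membership.Propositional.Properties using (∈-allFin; ∈-map⁺; ∈-map⁻; ∈-++⁺ˡ; ∈-++⁺ʳ)
import Data.List.Membership.DecPropositional as DecMembership
open import Data.List.Relation.Unary.Any using (here; there; _─_; satisfied)
open import Data.List.Relation.Unary.Any.Properties using (any⁻)
import Data.List.Relation.Unary.All as All
open import Data.List.Relation.Unary.All.Properties using (all⁺)
open import Data.List.Relation.Unary.AllPairs using ([]; _∷_)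
open import Data.List.Relation.Unary.Unique.Propositional using (Unique)
open import Data.List.Relation.Unary.Unique.Propositional.Properties using (allFin⁺; map⁺; ++⁺)
open import Data.Product using (_×_; _,_; proj₁; proj₂; ∃; ∃-syntax)
open import Data.Sum using (_⊎_; inj₁; inj₂; swap; [_,_]′)
open import Data.Empty using (⊥; ⊥-elim)
open import Function using (_∘_; case_of_)
open import Function.Bundles using (Equivalence)
open import Relation.Nullary using (¬_; Dec; yes; no)
open import Relation.Nullary.Decidable using (_⊎-dec_; map′; isYes; toWitnessFalse)
open import Relation.Binary.PropositionalEquality

module _ {A : Set} where

  length-─ : ∀ {x} (xs : List A) (x∈ : x ∈ xs) → suc (length (xs ─ x∈)) ≡ length xs
  length-─ (_ ∷ _)  (here _)  = refl
  length-─ (_ ∷ xs) (there p) = cong suc (length-─ xs p)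

  ∈-─ : ∀ {x y} (xs : List A) (x∈ : x ∈ xs) → y ∈ xs → y ≢ x → y ∈ (xs ─ x∈)
  ∈-─ (_ ∷ _)  (here refl) (here refl) y≢x = ⊥-elim (y≢x refl)
  ∈-─ (_ ∷ _)  (here refl) (there y∈)  _   = y∈
  ∈-─ (_ ∷ _)  (there _)   (here refl) _   = here refl
  ∈-─ (_ ∷ xs) (there x∈)  (there y∈)  y≢x = there (∈-─ xs x∈ y∈ y≢x)

  Unique-⊆⇒length≤ : ∀ xs ys → Unique xs → (∀ {x} → x ∈ xs → x ∈ ys) → length xs ≤ length ys
  Unique-⊆⇒length≤ []       ys _              _   = z≤n
  Unique-⊆⇒length≤ (x ∷ xs) ys (x∉xs ∷ uniq) sub =
    subst (suc (length xs) ≤_) (length-─ ys x∈ys)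
      (s≤s (Unique-⊆⇒length≤ xs (ys ─ x∈ys) uniq
        (λ y∈xs → ∈-─ ys x∈ys (sub (there y∈xs)) (λ y≡x → All.lookup x∉xs y∈xs (sym y≡x)))))
    where x∈ys = sub (here refl)

  all-or-counterexample : {R : A → Set} → (∀ x → Dec (R x)) → (xs : List A) →
                          (∀ x → x ∈ xs → R x) ⊎ ∃ λ x → x ∈ xs × ¬ R x
  all-or-counterexample R? [] = inj₁ λ _ ()
  all-or-counterexample R? (y ∷ xs) with R? y | all-or-counterexample R? xs
  ... | no ¬r | _                  = inj₂ (y , here refl , ¬r)
  ... | yes _ | inj₂ (x , x∈ , ¬r) = inj₂ (x , there x∈ , ¬r)
  ... | yes r | inj₁ rest          = inj₁ λ { _ (here refl) → r ; x (there x∈) → rest x x∈ }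

covering⇒length≥ : ∀ k (xs : List (Fin k)) → (∀ i → i ∈ xs) → k ≤ length xs
covering⇒length≥ k xs covers =
  subst (_≤ length xs) (length-tabulate {A = Fin k} (λ i → i))
    (Unique-⊆⇒length≤ (allFin k) xs (allFin⁺ k) (λ {i} _ → covers i))

covering-but-one : ∀ k (xs : List (Fin k)) i₀ → (∀ i → i ≡ i₀ ⊎ i ∈ xs) → k ≤ suc (length xs)
covering-but-one k xs i₀ covers = covering⇒length≥ k (i₀ ∷ xs) λ i → [ here , there ]′ (covers i)

module _ {A B : Set} (f : A → Maybe B) where

  justs : List A → List B
  justs [] = []
  justs (x ∷ xs) with f x
  ... | just y  = y ∷ justs xs
  ... | nothing = justs xs

  nothings : List A → List A
  nothings [] = []
  nothings (x ∷ xs) with f x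
  ... | just _  = nothings xs
  ... | nothing = x ∷ nothings xs

  length-justs+nothings : ∀ xs → length (justs xs) + length (nothings xs) ≡ length xs
  length-justs+nothings [] = refl
  length-justs+nothings (x ∷ xs) with f x
  ... | just _  = cong suc (length-justs+nothings xs)
  ... | nothing = trans (+-suc (length (justs xs)) _) (cong suc (length-justs+nothings xs))

  ∈-justs : ∀ {x y} xs → x ∈ xs → f x ≡ just y → y ∈ justs xs
  ∈-justs (z ∷ xs) (here refl) fx≡y with f z
  ∈-justs (z ∷ xs) (here refl) refl | just _ = here refl
  ∈-justs (z ∷ xs) (there x∈)  fx≡y with f z
  ... | just _  = there (∈-justs xs x∈ fx≡y)
  ... | nothing = ∈-justs xs x∈ fx≡y

  ∈-nothings : ∀ {x} xs → x ∈ xs → f x ≡ nothing → x ∈ nothings xs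
  ∈-nothings (z ∷ xs) (here refl) fx≡n with f z
  ∈-nothings (z ∷ xs) (here refl) refl | nothing = here refl
  ∈-nothings (z ∷ xs) (there x∈)  fx≡n with f z
  ... | just _  = ∈-nothings xs x∈ fx≡n
  ... | nothing = there (∈-nothings xs x∈ fx≡n)

module Walks {V : Set} (Adj : V → V → Set) (Adj-sym : ∀ {x y} → Adj x y → Adj y x) where
  open GraphNotions Adj

  infixr 5 _++ʷ_

  _++ʷ_ : ∀ {x y z a b} → Walk x y a → Walk y z b → Walk x z (a + b)
  here     ++ʷ w′ = w′
  (e ∷ w) ++ʷ w′ = e ∷ (w ++ʷ w′)

  snocʷ : ∀ {x y z k} → Walk x y k → Adj y z → Walk x z (suc k)
  snocʷ here    e′ = e′ ∷ here
  snocʷ (e ∷ w) e′ = e ∷ snocʷ w e′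

  reverseʷ : ∀ {x y k} → Walk x y k → Walk y x k
  reverseʷ here    = here
  reverseʷ (e ∷ w) = snocʷ (reverseʷ w) (Adj-sym e)

  castʷ : ∀ {x y a b} → a ≡ b → Walk x y a → Walk x y b
  castʷ refl w = w

Resolving-⊆ : ∀ {V} {Adj : V → V → Set} {W W′} → (∀ {w} → w ∈ W → w ∈ W′) →
              GraphNotions.Resolving Adj W → GraphNotions.Resolving Adj W′
Resolving-⊆ W⊆W′ resolving u v u≢v with resolving u v u≢v
... | w , w∈ , differ = w , W⊆W′ w∈ , differ

-- Being zero on the diagonal and changing by at most one along an edge, δ bounds the length of
-- every walk from below; since it is realised by walks, it is the graph distance.
module DistanceFunction {V : Set} (Adj : V → V → Set) (δ : V → V → ℕ)
  (walk : ∀ x y → GraphNotions.Walk Adj x y (δ x y))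
  (δ-diagonal : ∀ y → δ y y ≡ 0)
  (δ-lipschitz : ∀ {x x′} → Adj x x′ → ∀ y → δ x y ≤ suc (δ x′ y)) where
  open GraphNotions Adj

  δ≤length : ∀ {x y k} → Walk x y k → δ x y ≤ k
  δ≤length {y = y} here    = ≤-reflexive (δ-diagonal y)
  δ≤length {y = y} (e ∷ w) = ≤-trans (δ-lipschitz e y) (s≤s (δ≤length w))

  Dist-δ : ∀ x y → Dist x y (δ x y)
  Dist-δ x y = walk x y , λ _ → δ≤length

  Dist⇒≡δ : ∀ {x y k} → Dist x y k → k ≡ δ x y
  Dist⇒≡δ {x} {y} (w , shortest) = ≤-antisym (shortest (δ x y) (walk x y)) (δ≤length w)

  Resolving-if-δ-injective : ∀ W → (∀ u v → (∀ w → w ∈ W → δ u w ≡ δ v w) → u ≡ v) → Resolving W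
  Resolving-if-δ-injective W injective u v u≢v
    with all-or-counterexample (λ w → δ u w ≟ δ v w) W
  ... | inj₁ same = ⊥-elim (u≢v (injective u v same))
  ... | inj₂ (w , w∈ , differ) =
    w , w∈ , λ a b da db a≡b → differ (trans (sym (Dist⇒≡δ da)) (trans a≡b (Dist⇒≡δ db)))

  ¬Resolving-if-confused : ∀ W u v → u ≢ v → (∀ w → w ∈ W → δ u w ≡ δ v w) → ¬ Resolving W
  ¬Resolving-if-confused W u v u≢v same resolving with resolving u v u≢v
  ... | w , w∈ , differ = differ (δ u w) (δ v w) (Dist-δ u w) (Dist-δ v w) (same w w∈)

-- Distances in the theta graph

Near : ℕ → ℕ → Set
Near a b = a ≤ suc b × b ≤ suc a

near-sym : ∀ {a b} → Near a b → Near b a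
near-sym (p , q) = q , p

near-suc : ∀ a → Near a (suc a)
near-suc a = ≤-trans (n≤1+n a) (n≤1+n (suc a)) , ≤-refl

near-⊓ : ∀ {a a′ b b′} → Near a a′ → Near b b′ → Near (a ⊓ b) (a′ ⊓ b′)
near-⊓ {a} {a′} {b} {b′} (p , p′) (q , q′) =
  ⊓-glb (≤-trans (m⊓n≤m a b) p) (≤-trans (m⊓n≤n a b) q) ,
  ⊓-glb (≤-trans (m⊓n≤m a′ b′) p′) (≤-trans (m⊓n≤n a′ b′) q′)

near-+ʳ : ∀ {a a′} c → Near a a′ → Near (a + c) (a′ + c)
near-+ʳ c (p , q) = +-monoˡ-≤ c p , +-monoˡ-≤ c q

near-∸ : ∀ x j → Near (x ∸ j) (x ∸ suc j)
near-∸ zero    zero    = z≤n , z≤n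
near-∸ zero    (suc j) = z≤n , z≤n
near-∸ (suc x) zero    = ≤-refl , ≤-trans (n≤1+n x) (n≤1+n (suc x))
near-∸ (suc x) (suc j) = near-∸ x j

near-∣-∣ : ∀ j l → Near ∣ j - l ∣ ∣ suc j - l ∣
near-∣-∣ zero    zero    = z≤n , ≤-refl
near-∣-∣ zero    (suc l) = ≤-refl , ≤-trans (n≤1+n l) (n≤1+n (suc l))
near-∣-∣ (suc j) zero    = near-suc (suc j)
near-∣-∣ (suc j) (suc l) = near-∣-∣ j l

⊓-glb-suc₃ : ∀ {x a b c} → x ≤ suc a → x ≤ suc b → x ≤ suc c → x ≤ suc (a ⊓ (b ⊓ c))
⊓-glb-suc₃ p q r = ⊓-glb p (⊓-glb q r)

-- Θ(s₁^{m-1}, s₂) with m = n + 4, s₁ = t + 1 and s₂ = s₁ + 1 + e; path zero is the long one.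
module ThetaDistance (n t e : ℕ) where

  m s₁ s₂ : ℕ
  m  = suc (suc (suc (suc n)))
  s₁ = suc t
  s₂ = suc (suc (t + e))

  s₁<s₂ : s₁ < s₂
  s₁<s₂ = s≤s (s≤s (m≤m+n t e))

  S : Fin m → ℕ
  S = thetaLengths m s₁ s₂

  open Theta m S public
  open Walks Adj swap public

  s₁≤S : ∀ i → s₁ ≤ S i
  s₁≤S F.zero    = <⇒≤ s₁<s₂
  s₁≤S (F.suc i) = ≤-refl

  -- d(c₁, c₂), attained along a short path
  D : ℕ
  D = suc s₁

  d₁ d₂ : Vertex → ℕ
  d₁ c₁          = 0
  d₁ c₂          = D
  d₁ (inner i j) = suc (toℕ j) ⊓ (S i ∸ toℕ j + D)
  d₂ c₁          = D
  d₂ c₂          = 0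
  d₂ (inner i j) = (S i ∸ toℕ j) ⊓ (suc (toℕ j) + D)

  via₁ via₂ : Vertex → Vertex → ℕ
  via₁ x y = d₁ x + d₁ y
  via₂ x y = d₂ x + d₂ y

  -- Off a common path no route runs along one; via₁ is a harmless stand-in there.
  alongPath : Vertex → Vertex → ℕ
  alongPath (inner i j) (inner k l) with i F.≟ k
  ... | yes _ = ∣ toℕ j - toℕ l ∣
  ... | no _  = via₁ (inner i j) (inner k l)
  alongPath x y = via₁ x y

  dist : Vertex → Vertex → ℕ
  dist x y = alongPath x y ⊓ (via₁ x y ⊓ via₂ x y)

  dist≤alongPath : ∀ x y → dist x y ≤ alongPath x y
  dist≤alongPath x y = m⊓n≤m _ _

  dist≤via₁ : ∀ x y → dist x y ≤ via₁ x y
  dist≤via₁ x y = ≤-trans (m⊓n≤n (alongPath x y) _) (m⊓n≤m _ _)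

  dist≤via₂ : ∀ x y → dist x y ≤ via₂ x y
  dist≤via₂ x y = ≤-trans (m⊓n≤n (alongPath x y) _) (m⊓n≤n _ _)

  alongPath-same : ∀ i j l → alongPath (inner i j) (inner i l) ≡ ∣ toℕ j - toℕ l ∣
  alongPath-same i j l with i F.≟ i
  ... | yes _  = refl
  ... | no i≢i = ⊥-elim (i≢i refl)

  alongPath-other : ∀ i j k l → i ≢ k → alongPath (inner i j) (inner k l) ≡ via₁ (inner i j) (inner k l)
  alongPath-other i j k l i≢k with i F.≟ k
  ... | yes i≡k = ⊥-elim (i≢k i≡k)
  ... | no _    = refl

  walk-down : ∀ i k (j : Fin (S i)) → toℕ j ≡ k → Walk (inner i j) c₁ (suc k)
  walk-down i zero    j j≡0 = inj₂ (start i j j≡0) ∷ here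
  walk-down i (suc k) j j≡k = inj₂ (step i j′ j (trans j≡k (cong suc (sym (FP.toℕ-fromℕ< k<S))))) ∷
                              walk-down i k j′ (FP.toℕ-fromℕ< k<S)
    where
      k<S : k < S i
      k<S = ≤-trans (n≤1+n (suc k)) (subst (λ z → suc z ≤ S i) j≡k (FP.toℕ<n j))
      j′ = fromℕ< k<S

  walk-up : ∀ i d (j : Fin (S i)) → suc (toℕ j) + d ≡ S i → Walk (inner i j) c₂ (suc d)
  walk-up i zero    j j+1≡S = inj₁ (end i j (trans (sym (+-identityʳ _)) j+1≡S)) ∷ here
  walk-up i (suc d) j j+d≡S = inj₁ (step i j j′ (FP.toℕ-fromℕ< j+1<S)) ∷ walk-up i d j′ j′+d≡S
    where
      j+1<S : suc (toℕ j) < S i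
      j+1<S = subst (suc (suc (toℕ j)) ≤_) (trans (sym (+-suc (suc (toℕ j)) d)) j+d≡S)
                (s≤s (m≤m+n (suc (toℕ j)) d))
      j′ = fromℕ< j+1<S
      j′+d≡S : suc (toℕ j′) + d ≡ S i
      j′+d≡S = trans (cong (λ z → suc z + d) (FP.toℕ-fromℕ< j+1<S)) (trans (sym (+-suc (suc (toℕ j)) d)) j+d≡S)

  walk-along : ∀ i d (j l : Fin (S i)) → toℕ j + d ≡ toℕ l → Walk (inner i j) (inner i l) d
  walk-along i zero    j l j≡l = subst (λ z → Walk (inner i j) (inner i z) 0)
                                   (FP.toℕ-injective (trans (sym (+-identityʳ _)) j≡l)) here
  walk-along i (suc d) j l j+d≡l = inj₁ (step i j j′ (FP.toℕ-fromℕ< j+1<S)) ∷ walk-along i d j′ l j′+d≡l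
    where
      j+1≤l : suc (toℕ j) ≤ toℕ l
      j+1≤l = subst (suc (toℕ j) ≤_) (trans (sym (+-suc (toℕ j) d)) j+d≡l) (s≤s (m≤m+n (toℕ j) d))
      j+1<S : suc (toℕ j) < S i
      j+1<S = ≤-trans (s≤s j+1≤l) (FP.toℕ<n l)
      j′ = fromℕ< j+1<S
      j′+d≡l : toℕ j′ + d ≡ toℕ l
      j′+d≡l = trans (cong (_+ d) (FP.toℕ-fromℕ< j+1<S)) (trans (sym (+-suc (toℕ j) d)) j+d≡l)

  walk-c₁c₂ : Walk c₁ c₂ D
  walk-c₁c₂ = inj₁ (start (F.suc F.zero) F.zero refl) ∷ walk-up (F.suc F.zero) t F.zero refl

  walk-inner-c₂ : ∀ i j → Walk (inner i j) c₂ (S i ∸ toℕ j)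
  walk-inner-c₂ i j = castʷ (sym (+-∸-assoc 1 (FP.toℕ<n j)))
                        (walk-up i (S i ∸ suc (toℕ j)) j (m+[n∸m]≡n (FP.toℕ<n j)))

  walk-d₁ : ∀ x → Walk x c₁ (d₁ x)
  walk-d₁ c₁ = here
  walk-d₁ c₂ = reverseʷ walk-c₁c₂
  walk-d₁ (inner i j) with ⊓-sel (suc (toℕ j)) (S i ∸ toℕ j + D)
  ... | inj₁ eq = castʷ (sym eq) (walk-down i (toℕ j) j refl)
  ... | inj₂ eq = castʷ (sym eq) (walk-inner-c₂ i j ++ʷ reverseʷ walk-c₁c₂)

  walk-d₂ : ∀ x → Walk x c₂ (d₂ x)
  walk-d₂ c₁ = walk-c₁c₂
  walk-d₂ c₂ = here
  walk-d₂ (inner i j) with ⊓-sel (S i ∸ toℕ j) (suc (toℕ j) + D)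
  ... | inj₁ eq = castʷ (sym eq) (walk-inner-c₂ i j)
  ... | inj₂ eq = castʷ (sym eq) (walk-down i (toℕ j) j refl ++ʷ walk-c₁c₂)

  walk-via₁ : ∀ x y → Walk x y (via₁ x y)
  walk-via₁ x y = walk-d₁ x ++ʷ reverseʷ (walk-d₁ y)

  walk-via₂ : ∀ x y → Walk x y (via₂ x y)
  walk-via₂ x y = walk-d₂ x ++ʷ reverseʷ (walk-d₂ y)

  walk-alongPath : ∀ x y → Walk x y (alongPath x y)
  walk-alongPath (inner i j) (inner k l) with i F.≟ k
  ... | no _ = walk-via₁ (inner i j) (inner k l)
  ... | yes refl with ≤-total (toℕ j) (toℕ l)
  ...   | inj₁ j≤l = castʷ (sym (m≤n⇒∣m-n∣≡n∸m j≤l)) (walk-along i (toℕ l ∸ toℕ j) j l (m+[n∸m]≡n j≤l))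
  ...   | inj₂ l≤j = castʷ (sym (m≤n⇒∣n-m∣≡n∸m l≤j))
                       (reverseʷ (walk-along i (toℕ j ∸ toℕ l) l j (m+[n∸m]≡n l≤j)))
  walk-alongPath (inner i j) c₁ = walk-via₁ _ _
  walk-alongPath (inner i j) c₂ = walk-via₁ _ _
  walk-alongPath c₁ y = walk-via₁ _ _
  walk-alongPath c₂ y = walk-via₁ _ _

  walk-dist : ∀ x y → Walk x y (dist x y)
  walk-dist x y with ⊓-sel (alongPath x y) (via₁ x y ⊓ via₂ x y)
  ... | inj₁ eq = castʷ (sym eq) (walk-alongPath x y)
  ... | inj₂ eq with ⊓-sel (via₁ x y) (via₂ x y)
  ...   | inj₁ eq′ = castʷ (sym (trans eq eq′)) (walk-via₁ x y)
  ...   | inj₂ eq′ = castʷ (sym (trans eq eq′)) (walk-via₂ x y)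

  S≢0 : ∀ i → S i ≢ 0
  S≢0 i S≡0 with subst (s₁ ≤_) S≡0 (s₁≤S i)
  ... | ()

  near-d₁ : ∀ {a b} → Edge a b → Near (d₁ a) (d₁ b)
  near-d₁ (start i j j≡0) = z≤n , ≤-trans (m⊓n≤m _ _) (≤-reflexive (cong suc j≡0))
  near-d₁ (step i j k k≡j+1) rewrite k≡j+1 =
    near-⊓ (near-suc _) (near-+ʳ D (near-∸ (S i) (toℕ j)))
  near-d₁ (end i j j+1≡S) = at-end (toℕ j) (S i) j+1≡S (s₁≤S i)
    where
      at-end : ∀ J s → suc J ≡ s → s₁ ≤ s → Near (suc J ⊓ (s ∸ J + D)) D
      at-end J .(suc J) refl s₁≤s rewrite m+n∸n≡m 1 J =
        m⊓n≤n (suc J) (suc D) , ⊓-glb (s≤s s₁≤s) (≤-trans (n≤1+n D) (n≤1+n (suc D)))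
  near-d₁ (direct i S≡0) = ⊥-elim (S≢0 i S≡0)

  near-d₂ : ∀ {a b} → Edge a b → Near (d₂ a) (d₂ b)
  near-d₂ (start i j j≡0) rewrite j≡0 =
    ⊓-glb (s≤s (s₁≤S i)) (≤-trans (n≤1+n D) (n≤1+n (suc D))) , m⊓n≤n (S i) (suc D)
  near-d₂ (step i j k k≡j+1) rewrite k≡j+1 =
    near-⊓ (near-∸ (S i) (toℕ j)) (near-+ʳ D (near-suc (suc (toℕ j))))
  near-d₂ (end i j j+1≡S) = at-end (toℕ j) (S i) j+1≡S
    where
      at-end : ∀ J s → suc J ≡ s → Near ((s ∸ J) ⊓ (suc J + D)) 0
      at-end J .(suc J) refl rewrite m+n∸n≡m 1 J = s≤s z≤n , z≤n
  near-d₂ (direct i S≡0) = ⊥-elim (S≢0 i S≡0)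

  ≡⊎≢ : (i k : Fin m) → i ≡ k ⊎ i ≢ k
  ≡⊎≢ i k with i F.≟ k
  ... | yes i≡k = inj₁ i≡k
  ... | no i≢k  = inj₂ i≢k

  dist≤via₁-near : ∀ {a b} y → Near (d₁ a) (d₁ b) → dist a y ≤ suc (via₁ b y)
  dist≤via₁-near {a} y near = ≤-trans (dist≤via₁ a y) (+-monoˡ-≤ (d₁ y) (proj₁ near))

  dist≤via₂-near : ∀ {a b} y → Near (d₂ a) (d₂ b) → dist a y ≤ suc (via₂ b y)
  dist≤via₂-near {a} y near = ≤-trans (dist≤via₂ a y) (+-monoˡ-≤ (d₂ y) (proj₁ near))

  dist≤via₁-tgt : ∀ {a b} → Edge a b → ∀ y → dist a y ≤ suc (via₁ b y)
  dist≤via₁-tgt {a} {b} e y = dist≤via₁-near {a} {b} y (near-d₁ e)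

  dist≤via₁-src : ∀ {a b} → Edge a b → ∀ y → dist b y ≤ suc (via₁ a y)
  dist≤via₁-src {a} {b} e y = dist≤via₁-near {b} {a} y (near-sym (near-d₁ e))

  dist≤via₂-tgt : ∀ {a b} → Edge a b → ∀ y → dist a y ≤ suc (via₂ b y)
  dist≤via₂-tgt {a} {b} e y = dist≤via₂-near {a} {b} y (near-d₂ e)

  dist≤via₂-src : ∀ {a b} → Edge a b → ∀ y → dist b y ≤ suc (via₂ a y)
  dist≤via₂-src {a} {b} e y = dist≤via₂-near {b} {a} y (near-sym (near-d₂ e))

  dist≤alongPath-other : ∀ a i j k l → i ≢ k → Near (d₁ a) (d₁ (inner i j)) →
                         dist a (inner k l) ≤ suc (alongPath (inner i j) (inner k l))
  dist≤alongPath-other a i j k l i≢k near =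
    subst (λ z → dist a (inner k l) ≤ suc z) (sym (alongPath-other i j k l i≢k))
      (dist≤via₁-near {a} {inner i j} (inner k l) near)

  dist≤alongPath-tgt : ∀ {a b} → Edge a b → ∀ y → dist a y ≤ suc (alongPath b y)
  dist≤alongPath-tgt e@(start i j _) c₁ = dist≤via₁-tgt e c₁
  dist≤alongPath-tgt e@(start i j _) c₂ = dist≤via₁-tgt e c₂
  dist≤alongPath-tgt e@(start i j j≡0) (inner k l) with ≡⊎≢ i k
  ... | inj₂ i≢k  = dist≤alongPath-other c₁ i j k l i≢k (near-d₁ e)
  ... | inj₁ refl = ≤-trans (dist≤via₁ c₁ (inner i l))
                      (≤-trans (m⊓n≤m _ _) (≤-reflexive (cong suc (sym
                        (trans (alongPath-same i j l) (cong (λ z → ∣ z - toℕ l ∣) j≡0))))))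
  dist≤alongPath-tgt e@(step i j k _) c₁ = dist≤via₁-tgt e c₁
  dist≤alongPath-tgt e@(step i j k _) c₂ = dist≤via₁-tgt e c₂
  dist≤alongPath-tgt e@(step i j k k≡j+1) (inner k′ l) with ≡⊎≢ i k′
  ... | inj₂ i≢k′ = dist≤alongPath-other (inner i j) i k k′ l i≢k′ (near-d₁ e)
  ... | inj₁ refl = begin
    dist (inner i j) (inner i l)      ≤⟨ dist≤alongPath (inner i j) (inner i l) ⟩
    alongPath (inner i j) (inner i l) ≡⟨ alongPath-same i j l ⟩
    ∣ toℕ j - toℕ l ∣                 ≤⟨ proj₁ (near-∣-∣ (toℕ j) (toℕ l)) ⟩
    suc ∣ suc (toℕ j) - toℕ l ∣       ≡⟨ cong suc (sym (trans (alongPath-same i k l) (cong (λ z → ∣ z - toℕ l ∣) k≡j+1))) ⟩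
    suc (alongPath (inner i k) (inner i l)) ∎
    where open ≤-Reasoning
  dist≤alongPath-tgt e@(end i j _) y = dist≤via₁-tgt e y
  dist≤alongPath-tgt (direct i S≡0) y = ⊥-elim (S≢0 i S≡0)

  dist≤alongPath-src : ∀ {a b} → Edge a b → ∀ y → dist b y ≤ suc (alongPath a y)
  dist≤alongPath-src e@(start i j _) y = dist≤via₁-src e y
  dist≤alongPath-src e@(step i j k _) c₁ = dist≤via₁-src e c₁
  dist≤alongPath-src e@(step i j k _) c₂ = dist≤via₁-src e c₂
  dist≤alongPath-src e@(step i j k k≡j+1) (inner k′ l) with ≡⊎≢ i k′
  ... | inj₂ i≢k′ = dist≤alongPath-other (inner i k) i j k′ l i≢k′ (near-sym (near-d₁ e))
  ... | inj₁ refl = begin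
    dist (inner i k) (inner i l)      ≤⟨ dist≤alongPath (inner i k) (inner i l) ⟩
    alongPath (inner i k) (inner i l) ≡⟨ trans (alongPath-same i k l) (cong (λ z → ∣ z - toℕ l ∣) k≡j+1) ⟩
    ∣ suc (toℕ j) - toℕ l ∣           ≤⟨ proj₂ (near-∣-∣ (toℕ j) (toℕ l)) ⟩
    suc ∣ toℕ j - toℕ l ∣             ≡⟨ cong suc (sym (alongPath-same i j l)) ⟩
    suc (alongPath (inner i j) (inner i l)) ∎
    where open ≤-Reasoning
  dist≤alongPath-src e@(end i j _) c₁ = dist≤via₁-src e c₁
  dist≤alongPath-src e@(end i j _) c₂ = dist≤via₁-src e c₂
  dist≤alongPath-src e@(end i j j+1≡S) (inner k l) with ≡⊎≢ i k
  ... | inj₂ i≢k  = dist≤alongPath-other c₂ i j k l i≢k (near-sym (near-d₁ e))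
  ... | inj₁ refl = ≤-trans (dist≤via₂ c₂ (inner i l))
                     (≤-trans (m⊓n≤m _ _) (≤-trans (at-end (toℕ j) (toℕ l) (S i) j+1≡S (FP.toℕ<n l))
                       (≤-reflexive (cong suc (sym (alongPath-same i j l))))))
    where
      at-end : ∀ J L s → suc J ≡ s → L < s → s ∸ L ≤ suc ∣ J - L ∣
      at-end J L .(suc J) refl (s≤s L≤J) rewrite +-∸-assoc 1 L≤J | m≤n⇒∣n-m∣≡n∸m L≤J = ≤-refl
  dist≤alongPath-src (direct i S≡0) y = ⊥-elim (S≢0 i S≡0)

  dist-lipschitz : ∀ {a b} → Adj a b → ∀ y → dist a y ≤ suc (dist b y)
  dist-lipschitz (inj₁ e) y = ⊓-glb-suc₃ (dist≤alongPath-tgt e y) (dist≤via₁-tgt e y) (dist≤via₂-tgt e y)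
  dist-lipschitz (inj₂ e) y = ⊓-glb-suc₃ (dist≤alongPath-src e y) (dist≤via₁-src e y) (dist≤via₂-src e y)

  dist-diagonal : ∀ y → dist y y ≡ 0
  dist-diagonal c₁ = refl
  dist-diagonal c₂ = refl
  dist-diagonal (inner i j) = n≤0⇒n≡0 (≤-trans (dist≤alongPath (inner i j) (inner i j))
                                (≤-reflexive (trans (alongPath-same i j j) (∣n-n∣≡0 (toℕ j)))))

  open DistanceFunction Adj dist walk-dist dist-diagonal dist-lipschitz public

  pattern long j    = inner F.zero j
  pattern short i j = inner (F.suc i) j

  first : Fin (suc (suc (suc n))) → Vertex
  first i = short i F.zero

  d₁-short : ∀ i (l : Fin s₁) → d₁ (short i l) ≡ suc (toℕ l)
  d₁-short i l = m≤n⇒m⊓n≡m (≤-trans (≤-trans (FP.toℕ<n l) (n≤1+n s₁)) (m≤n+m D (s₁ ∸ toℕ l)))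

  d₂-short : ∀ i (l : Fin s₁) → d₂ (short i l) ≡ s₁ ∸ toℕ l
  d₂-short i l = m≤n⇒m⊓n≡m (≤-trans (m∸n≤m s₁ (toℕ l)) (≤-trans (n≤1+n s₁) (m≤n+m D (suc (toℕ l)))))

  d₁-long₀ : d₁ (long F.zero) ≡ 1
  d₁-long₀ = m≤n⇒m⊓n≡m {1} {s₂ + D} (s≤s z≤n)

  s₁≤d₂-long₀ : s₁ ≤ d₂ (long F.zero)
  s₁≤d₂-long₀ = ⊓-glb (<⇒≤ s₁<s₂) (≤-trans (n≤1+n s₁) (n≤1+n D))

  dist-other-path : ∀ i j k l → i ≢ k →
    dist (inner i j) (inner k l) ≡ via₁ (inner i j) (inner k l) ⊓ via₂ (inner i j) (inner k l)
  dist-other-path i j k l i≢k = begin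
    alongPath x y ⊓ (via₁ x y ⊓ via₂ x y) ≡⟨ cong (_⊓ (via₁ x y ⊓ via₂ x y)) (alongPath-other i j k l i≢k) ⟩
    via₁ x y ⊓ (via₁ x y ⊓ via₂ x y)      ≡⟨ sym (⊓-assoc (via₁ x y) _ _) ⟩
    via₁ x y ⊓ via₁ x y ⊓ via₂ x y        ≡⟨ cong (_⊓ via₂ x y) (⊓-idem (via₁ x y)) ⟩
    via₁ x y ⊓ via₂ x y                   ∎
    where
      open ≡-Reasoning
      x = inner i j
      y = inner k l

  dist≡via₁ : ∀ x y → alongPath x y ≡ via₁ x y → via₁ x y ≤ via₂ x y → dist x y ≡ via₁ x y
  dist≡via₁ x y along≡ ≤via₂ rewrite along≡ | m≤n⇒m⊓n≡m ≤via₂ = ⊓-idem (via₁ x y)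

  dist≡ : ∀ x y r → dist x y ≤ r → r ≤ alongPath x y → r ≤ via₁ x y → r ≤ via₂ x y → dist x y ≡ r
  dist≡ x y r ≤r r≤along r≤via₁ r≤via₂ = ≤-antisym ≤r (⊓-glb r≤along (⊓-glb r≤via₁ r≤via₂))

  2+l≤s₁+[s₁∸l] : ∀ (l : Fin s₁) → suc (suc (toℕ l)) ≤ s₁ + (s₁ ∸ toℕ l)
  2+l≤s₁+[s₁∸l] l = subst (_≤ s₁ + (s₁ ∸ toℕ l)) (+-comm (suc (toℕ l)) 1)
                      (+-mono-≤ (FP.toℕ<n l) (m<n⇒0<n∸m (FP.toℕ<n l)))

  dist-short-first : ∀ i i′ (l : Fin s₁) → i ≢ i′ → dist (short i l) (first i′) ≡ suc (suc (toℕ l))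
  dist-short-first i i′ l i≢i′ =
    trans (dist≡via₁ x y (alongPath-other (F.suc i) l (F.suc i′) F.zero (i≢i′ ∘ FP.suc-injective)) ≤via₂) via₁≡
    where
      x = short i l
      y = first i′
      via₁≡ : via₁ x y ≡ suc (suc (toℕ l))
      via₁≡ = trans (cong₂ _+_ (d₁-short i l) (d₁-short i′ F.zero)) (+-comm (suc (toℕ l)) 1)
      ≤via₂ : via₁ x y ≤ via₂ x y
      ≤via₂ = subst₂ _≤_ (sym via₁≡)
                (sym (trans (cong₂ _+_ (d₂-short i l) (d₂-short i′ F.zero)) (+-comm (s₁ ∸ toℕ l) s₁)))
                (2+l≤s₁+[s₁∸l] l)

  up : Fin s₂ → ℕ
  up j = s₂ ∸ toℕ j

  1≤up : ∀ j → 1 ≤ up j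
  1≤up j = m<n⇒0<n∸m (FP.toℕ<n j)

  j+up≡s₂ : ∀ j → toℕ j + up j ≡ s₂
  j+up≡s₂ j = m+[n∸m]≡n (<⇒≤ (FP.toℕ<n j))

  ⊓+-lower : ∀ {r} a b c → r ≤ a + c → r ≤ b + c → r ≤ (a ⊓ b) + c
  ⊓+-lower a b c p q with ⊓-sel a b
  ... | inj₁ eq rewrite eq = p
  ... | inj₂ eq rewrite eq = q

  ⊓+⊓-lower : ∀ {r} a b c d → r ≤ a + c → r ≤ a + d → r ≤ b + c → r ≤ b + d → r ≤ (a ⊓ b) + (c ⊓ d)
  ⊓+⊓-lower a b c d p₁ p₂ p₃ p₄ with ⊓-sel a b | ⊓-sel c d
  ... | inj₁ eq | inj₁ eq′ rewrite eq | eq′ = p₁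
  ... | inj₁ eq | inj₂ eq′ rewrite eq | eq′ = p₂
  ... | inj₂ eq | inj₁ eq′ rewrite eq | eq′ = p₃
  ... | inj₂ eq | inj₂ eq′ rewrite eq | eq′ = p₄

  ≤-by : ∀ {a b} k → a + k ≡ b → a ≤ b
  ≤-by {a} k a+k≡b = subst (a ≤_) a+k≡b (m≤m+n a k)

  dist-long-first : ∀ i (j : Fin s₂) → dist (long j) (first i) ≡ suc (suc (toℕ j)) ⊓ (s₁ + up j)
  dist-long-first i j = dist≡ x y r (⊓-glb (≤-trans (dist≤via₁ x y) via₁≤) (≤-trans (dist≤via₂ x y) via₂≤))
                          r≤via₁ r≤via₁ r≤via₂
    where
      ĵ = toℕ j
      c = up j
      x = long j
      y = first i
      r = suc (suc ĵ) ⊓ (s₁ + c)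
      via₁≤ : via₁ x y ≤ suc (suc ĵ)
      via₁≤ = subst (_≤ suc (suc ĵ)) (sym (cong (d₁ x +_) (d₁-short i F.zero)))
                (≤-trans (+-monoˡ-≤ 1 (m⊓n≤m (suc ĵ) (c + D))) (≤-reflexive (+-comm (suc ĵ) 1)))
      via₂≤ : via₂ x y ≤ s₁ + c
      via₂≤ = subst (_≤ s₁ + c) (sym (cong (d₂ x +_) (d₂-short i F.zero)))
                (≤-trans (+-monoˡ-≤ s₁ (m⊓n≤m c (suc ĵ + D))) (≤-reflexive (+-comm c s₁)))
      r≤via₁ : r ≤ via₁ x y
      r≤via₁ = subst (r ≤_) (sym (cong (d₁ x +_) (d₁-short i F.zero)))
        (⊓+-lower (suc ĵ) (c + D) 1 (≤-trans (m⊓n≤m (suc (suc ĵ)) (s₁ + c)) (≤-reflexive (+-comm 1 (suc ĵ))))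
                                    (≤-trans (m⊓n≤n (suc (suc ĵ)) (s₁ + c)) (≤-by 2 (arrange s₁ c))))
        where
          arrange : ∀ s c → s + c + 2 ≡ c + suc s + 1
          arrange = solve-∀
      r≤via₂ : r ≤ via₂ x y
      r≤via₂ = subst (r ≤_) (sym (cong (d₂ x +_) (d₂-short i F.zero)))
        (⊓+-lower c (suc ĵ + D) s₁ (≤-trans (m⊓n≤n (suc (suc ĵ)) (s₁ + c)) (≤-reflexive (+-comm s₁ c)))
                                   (≤-trans (m⊓n≤m (suc (suc ĵ)) (s₁ + c)) (≤-by (s₁ + s₁) (arrange ĵ s₁))))
        where
          arrange : ∀ ĵ s → suc (suc ĵ) + (s + s) ≡ suc ĵ + suc s + s
          arrange = solve-∀

  dist-c₂-first : ∀ i → dist c₂ (first i) ≡ s₁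
  dist-c₂-first i = dist≡ c₂ y s₁ (≤-trans (dist≤via₂ c₂ y) (≤-reflexive (d₂-short i F.zero)))
                      s₁≤via₁ s₁≤via₁ (≤-reflexive (sym (d₂-short i F.zero)))
    where
      y = first i
      s₁≤via₁ : s₁ ≤ via₁ c₂ y
      s₁≤via₁ = ≤-trans (n≤1+n s₁) (m≤m+n D (d₁ y))

  dist-c₂-long₀ : dist c₂ (long F.zero) ≡ s₂ ⊓ suc D
  dist-c₂-long₀ = dist≡ c₂ (long F.zero) _ (dist≤via₂ c₂ (long F.zero)) ≤via₁ ≤via₁ ≤-refl
    where
      ≤via₁ : s₂ ⊓ suc D ≤ via₁ c₂ (long F.zero)
      ≤via₁ = ≤-trans (m⊓n≤n s₂ (suc D)) (≤-reflexive (sym (+-comm D 1)))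

  dist-short-long₀ : ∀ i (j : Fin s₁) → dist (short i j) (long F.zero) ≡ suc (suc (toℕ j))
  dist-short-long₀ i j = trans (dist≡via₁ x (long F.zero) refl ≤via₂) via₁≡
    where
      x = short i j
      via₁≡ : via₁ x (long F.zero) ≡ suc (suc (toℕ j))
      via₁≡ = trans (cong (_+ 1) (d₁-short i j)) (+-comm (suc (toℕ j)) 1)
      ≤via₂ : via₁ x (long F.zero) ≤ via₂ x (long F.zero)
      ≤via₂ = subst (_≤ via₂ x (long F.zero)) (sym via₁≡)
        (subst (suc (suc (toℕ j)) ≤_) (sym (cong (_+ d₂ (long F.zero)) (d₂-short i j)))
          (≤-trans (2+l≤s₁+[s₁∸l] j)
            (≤-trans (≤-reflexive (+-comm s₁ (s₁ ∸ toℕ j))) (+-monoʳ-≤ (s₁ ∸ toℕ j) s₁≤d₂-long₀))))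

  dist-long-long₀ : ∀ (j : Fin s₂) → dist (long j) (long F.zero) ≡ toℕ j ⊓ (s₁ + up j + 2)
  dist-long-long₀ j = dist≡ x (long F.zero) r ≤r (≤-trans (m⊓n≤m ĵ _) (≤-reflexive (sym along≡))) r≤via₁ r≤via₂
    where
      ĵ = toℕ j
      c = up j
      x = long j
      r = ĵ ⊓ (s₁ + c + 2)
      along≡ : alongPath x (long F.zero) ≡ ĵ
      along≡ = trans (alongPath-same F.zero j F.zero) (∣-∣-identityʳ ĵ)
      eq₁ : ∀ s c → c + suc s + 1 ≡ s + c + 2
      eq₁ = solve-∀
      eq₂ : ∀ s c → s + c + 2 ≡ c + suc (suc s)
      eq₂ = solve-∀
      ≤r : dist x (long F.zero) ≤ r
      ≤r = ⊓-glb (≤-trans (dist≤alongPath x (long F.zero)) (≤-reflexive along≡))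
                 (≤-trans (dist≤via₁ x (long F.zero))
                   (≤-trans (+-monoˡ-≤ 1 (m⊓n≤n (suc ĵ) (c + D))) (≤-reflexive (eq₁ s₁ c))))
      r≤via₁ : r ≤ via₁ x (long F.zero)
      r≤via₁ = ⊓+-lower (suc ĵ) (c + D) 1 (≤-trans (m⊓n≤m ĵ _) (≤-trans (n≤1+n ĵ) (m≤m+n (suc ĵ) 1)))
                                         (≤-trans (m⊓n≤n ĵ _) (≤-reflexive (sym (eq₁ s₁ c))))
      r≤via₂ : r ≤ via₂ x (long F.zero)
      r≤via₂ = ⊓+⊓-lower c (suc ĵ + D) s₂ (suc D)
        (≤-trans (m⊓n≤m ĵ _) (≤-trans (<⇒≤ (FP.toℕ<n j)) (m≤n+m s₂ c)))
        (≤-trans (m⊓n≤n ĵ _) (≤-reflexive (eq₂ s₁ c)))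
        (≤-trans (m⊓n≤m ĵ _) (≤-trans (n≤1+n ĵ) (≤-trans (m≤m+n (suc ĵ) D) (m≤m+n _ s₂))))
        (≤-trans (m⊓n≤m ĵ _) (≤-trans (n≤1+n ĵ) (≤-trans (m≤m+n (suc ĵ) D) (m≤m+n _ (suc D)))))

-- The lower bound β ≥ m - 1

module LowerBound (n t e : ℕ) where
  open ThetaDistance n t e
  open DecMembership (FP._≟_ {suc (suc (suc n))}) using (_∈?_)

  shortPathOf : Vertex → Maybe (Fin (suc (suc (suc n))))
  shortPathOf (short i _) = just i
  shortPathOf _           = nothing

  OnShortPath : Vertex → Set
  OnShortPath w = ∃ λ i → shortPathOf w ≡ just i

  onShortPath? : ∀ w → Dec (OnShortPath w)
  onShortPath? w with shortPathOf w
  ... | just i  = yes (i , refl)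
  ... | nothing = no λ ()

  ¬OnShortPath⇒nothing : ∀ w → ¬ OnShortPath w → shortPathOf w ≡ nothing
  ¬OnShortPath⇒nothing w ¬on with shortPathOf w
  ... | just i  = ⊥-elim (¬on (i , refl))
  ... | nothing = refl

  hitPaths : List Vertex → List (Fin (suc (suc (suc n))))
  hitPaths = justs shortPathOf

  unhit⇒≢ : ∀ {W i₀ k l} → i₀ ∉ hitPaths W → short k l ∈ W → k ≢ i₀
  unhit⇒≢ {W} i₀∉ w∈ refl = i₀∉ (∈-justs shortPathOf W w∈ refl)

  dist-unhit : ∀ {W i₀ i₁} → i₀ ∉ hitPaths W → i₁ ∉ hitPaths W →
               ∀ {k l} → short k l ∈ W → dist (short i₀ F.zero) (short k l) ≡ dist (short i₁ F.zero) (short k l)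
  dist-unhit i₀∉ i₁∉ {k} {l} w∈ =
    trans (dist-other-path _ F.zero _ l (λ eq → unhit⇒≢ i₀∉ w∈ (sym (FP.suc-injective eq))))
          (sym (dist-other-path _ F.zero _ l (λ eq → unhit⇒≢ i₁∉ w∈ (sym (FP.suc-injective eq)))))

  ¬Resolving-two-unhit : ∀ W i₀ i₁ → i₀ ≢ i₁ → i₀ ∉ hitPaths W → i₁ ∉ hitPaths W → ¬ Resolving W
  ¬Resolving-two-unhit W i₀ i₁ i₀≢i₁ i₀∉ i₁∉ =
    ¬Resolving-if-confused W (first i₀) (first i₁) (λ { refl → i₀≢i₁ refl }) same
    where
      same : ∀ w → w ∈ W → dist (first i₀) w ≡ dist (first i₁) w
      same c₁          _  = refl
      same c₂          _  = refl
      same (long _)    _  = refl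
      same (short k l) w∈ = dist-unhit i₀∉ i₁∉ w∈

  ¬Resolving-unhit-allShort : ∀ W i₀ → i₀ ∉ hitPaths W → (∀ w → w ∈ W → OnShortPath w) → ¬ Resolving W
  ¬Resolving-unhit-allShort W i₀ i₀∉ allShort =
    ¬Resolving-if-confused W (first i₀) (long F.zero) (λ ()) same
    where
      same : ∀ w → w ∈ W → dist (first i₀) w ≡ dist (long F.zero) w
      same w w∈ with allShort w w∈
      same (short k l) w∈ | _ = begin
        dist (first i₀) (short k l)      ≡⟨ dist≡via₁ (first i₀) w along≡ ≤via₂ ⟩
        via₁ (first i₀) (short k l)      ≡⟨⟩
        1 + d₁ (short k l)               ≡⟨ cong (_+ d₁ w) (sym d₁-long₀) ⟩
        via₁ (long F.zero) (short k l)   ≡⟨ sym (dist≡via₁ (long F.zero) w refl ≤via₂′) ⟩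
        dist (long F.zero) (short k l)   ∎
        where
          open ≡-Reasoning
          w = short k l
          along≡ = alongPath-other (F.suc i₀) F.zero (F.suc k) l (λ eq → unhit⇒≢ i₀∉ w∈ (sym (FP.suc-injective eq)))
          round : suc (suc (toℕ l)) ≤ s₁ + d₂ w
          round = subst (λ z → suc (suc (toℕ l)) ≤ s₁ + z) (sym (d₂-short k l)) (2+l≤s₁+[s₁∸l] l)
          ≤via₂ : via₁ (first i₀) w ≤ via₂ (first i₀) w
          ≤via₂ = subst₂ _≤_ (cong suc (sym (d₁-short k l))) (cong (_+ d₂ w) (sym (d₂-short i₀ F.zero))) round
          ≤via₂′ : via₁ (long F.zero) w ≤ via₂ (long F.zero) w
          ≤via₂′ = subst₂ _≤_ (cong₂ _+_ (sym d₁-long₀) (sym (d₁-short k l))) refl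
                     (≤-trans round (+-monoˡ-≤ (d₂ w) s₁≤d₂-long₀))

  length-hitPaths : ∀ W → length (hitPaths W) ≤ length W
  length-hitPaths W = subst (length (hitPaths W) ≤_) (length-justs+nothings shortPathOf W) (m≤m+n _ _)

  length-hitPaths< : ∀ W w → w ∈ W → shortPathOf w ≡ nothing → length (hitPaths W) < length W
  length-hitPaths< W w w∈ off with nothings shortPathOf W | ∈-nothings shortPathOf W w∈ off | length-justs+nothings shortPathOf W
  ... | _ ∷ _ | _ | eq = subst (length (hitPaths W) <_) eq (≤-trans (s≤s (m≤m+n _ _)) (≤-reflexive (sym (+-suc _ _))))

  m∸1≤resolving : ∀ W → Resolving W → suc (suc (suc n)) ≤ length W
  m∸1≤resolving W resolving with all-or-counterexample (_∈? hitPaths W) (allFin _)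
  ... | inj₁ allHit = ≤-trans (covering⇒length≥ _ (hitPaths W) (λ i → allHit i (∈-allFin i))) (length-hitPaths W)
  ... | inj₂ (i₀ , _ , i₀∉) with all-or-counterexample (λ i → (i FP.≟ i₀) ⊎-dec (i ∈? hitPaths W)) (allFin _)
  ...   | inj₂ (i₁ , _ , ¬covered) =
    ⊥-elim (¬Resolving-two-unhit W i₀ i₁ (λ eq → ¬covered (inj₁ (sym eq))) i₀∉ (¬covered ∘ inj₂) resolving)
  ...   | inj₁ covered with all-or-counterexample onShortPath? W
  ...     | inj₂ (w , w∈ , off) = ≤-trans (covering-but-one _ (hitPaths W) i₀ (λ i → covered i (∈-allFin i)))
                                          (length-hitPaths< W w w∈ (¬OnShortPath⇒nothing w off))
  ...     | inj₁ allShort = ⊥-elim (¬Resolving-unhit-allShort W i₀ i₀∉ allShort resolving)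

-- Resolving sets

module LandmarkFamily (n t e q : ℕ)
  (path : Fin (suc (suc q)) → Fin (suc (suc (suc n))))
  (path-injective : ∀ {k k′} → path k ≡ path k′ → k ≡ k′)
  (member : ThetaDistance.Vertex n t e → Maybe (Fin (suc (suc q))))
  (member-just : ∀ x k → member x ≡ just k → ∃ λ j → x ≡ ThetaDistance.inner (F.suc (path k)) j)
  (member-short : ∀ k j → member (ThetaDistance.inner (F.suc (path k)) j) ≡ just k)
  where
  open ThetaDistance n t e

  firstOf : Fin (suc (suc q)) → Vertex
  firstOf k = first (path k)

  landmarks : List Vertex → List Vertex
  landmarks E = map firstOf (allFin _) ++ E

  other : Fin (suc (suc q)) → Fin (suc (suc q))
  other F.zero    = F.suc F.zero
  other (F.suc _) = F.zero

  other≢ : ∀ k → other k ≢ k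
  other≢ F.zero    ()
  other≢ (F.suc k) ()

  nonmember-≢ : ∀ i j → member (short i j) ≡ nothing → ∀ k → i ≢ path k
  nonmember-≢ i j off k refl with trans (sym (member-short k j)) off
  ... | ()

  dist-member-ownFirst : ∀ k (j : Fin s₁) → dist (short (path k) j) (firstOf k) ≡ toℕ j
  dist-member-ownFirst k j =
    trans (cong (_⊓ (via₁ x w ⊓ via₂ x w)) (trans (alongPath-same (F.suc (path k)) j F.zero) (∣-∣-identityʳ (toℕ j))))
          (m≤n⇒m⊓n≡m (⊓-glb j≤via₁ j≤via₂))
    where
      x = short (path k) j
      w = firstOf k
      j≤via₁ : toℕ j ≤ via₁ x w
      j≤via₁ = subst (toℕ j ≤_) (sym (cong (_+ d₁ w) (d₁-short (path k) j))) (≤-trans (n≤1+n _) (m≤m+n _ _))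
      j≤via₂ : toℕ j ≤ via₂ x w
      j≤via₂ = subst (toℕ j ≤_) (sym (cong₂ _+_ (d₂-short (path k) j) (d₂-short (path k) F.zero)))
                 (≤-trans (<⇒≤ (FP.toℕ<n j)) (m≤n+m s₁ _))

  dist-member-otherFirst : ∀ k k′ (j : Fin s₁) → k′ ≢ k → dist (short (path k) j) (firstOf k′) ≡ suc (suc (toℕ j))
  dist-member-otherFirst k k′ j k′≢k = dist-short-first (path k) (path k′) j (λ eq → k′≢k (sym (path-injective eq)))

  dist-nonmember-firsts : ∀ x → member x ≡ nothing → ∀ k k′ → dist x (firstOf k) ≡ dist x (firstOf k′)
  dist-nonmember-firsts c₁ _ k k′ = refl
  dist-nonmember-firsts c₂ _ k k′ = refl
  dist-nonmember-firsts (long j) _ k k′ = refl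
  dist-nonmember-firsts (short i j) off k k′ =
    trans (dist-other-path (F.suc i) j (F.suc (path k)) F.zero (nonmember-≢ i j off k ∘ FP.suc-injective))
          (sym (dist-other-path (F.suc i) j (F.suc (path k′)) F.zero (nonmember-≢ i j off k′ ∘ FP.suc-injective)))

  firstOf∈ : ∀ E k → firstOf k ∈ landmarks E
  firstOf∈ E k = ∈-++⁺ˡ (∈-map⁺ firstOf (∈-allFin k))

  SameOn : List Vertex → Vertex → Vertex → Set
  SameOn W u v = ∀ w → w ∈ W → dist u w ≡ dist v w

  -- A member at depth j is at distance j from its own first vertex and j + 2 from every other one,
  -- which pins down both its path and its depth.
  member-determined : ∀ E u v k → member u ≡ just k → SameOn (landmarks E) u v → u ≡ v
  member-determined E u v k u∈ same with member-just u k u∈ | member v in v∈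
  ... | j , refl | nothing = ⊥-elim (m≢1+n+m (toℕ j) {1} (begin
    toℕ j                                 ≡⟨ sym (dist-member-ownFirst k j) ⟩
    dist u (firstOf k)                    ≡⟨ same (firstOf k) (firstOf∈ E k) ⟩
    dist v (firstOf k)                    ≡⟨ dist-nonmember-firsts v v∈ k (other k) ⟩
    dist v (firstOf (other k))            ≡⟨ sym (same (firstOf (other k)) (firstOf∈ E (other k))) ⟩
    dist u (firstOf (other k))            ≡⟨ dist-member-otherFirst k (other k) j (other≢ k) ⟩
    suc (suc (toℕ j))                     ∎))
    where open ≡-Reasoning
  ... | j , refl | just k′ with member-just v k′ v∈
  ...   | j′ , refl with k′ FP.≟ k
  ...     | yes refl = cong (short (path k)) (FP.toℕ-injective (begin
    toℕ j              ≡⟨ sym (dist-member-ownFirst k j) ⟩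
    dist u (firstOf k) ≡⟨ same (firstOf k) (firstOf∈ E k) ⟩
    dist v (firstOf k) ≡⟨ dist-member-ownFirst k j′ ⟩
    toℕ j′             ∎))
    where open ≡-Reasoning
  ...     | no k′≢k = ⊥-elim (m≢1+n+m (toℕ j′) {3} (begin
    toℕ j′                        ≡⟨ sym (dist-member-ownFirst k′ j′) ⟩
    dist v (firstOf k′)           ≡⟨ sym (same (firstOf k′) (firstOf∈ E k′)) ⟩
    dist u (firstOf k′)           ≡⟨ dist-member-otherFirst k k′ j k′≢k ⟩
    suc (suc (toℕ j))             ≡⟨ cong (suc ∘ suc) j≡j′+2 ⟩
    suc (suc (suc (suc (toℕ j′)))) ∎))
    where
      open ≡-Reasoning
      j≡j′+2 : toℕ j ≡ suc (suc (toℕ j′))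
      j≡j′+2 = trans (sym (dist-member-ownFirst k j))
                 (trans (same (firstOf k) (firstOf∈ E k)) (dist-member-otherFirst k′ k j′ (k′≢k ∘ sym)))

  Resolving-landmarks : ∀ E →
    (∀ u v → member u ≡ nothing → member v ≡ nothing →
       dist u (firstOf F.zero) ≡ dist v (firstOf F.zero) → SameOn E u v → u ≡ v) →
    Resolving (landmarks E)
  Resolving-landmarks E separates = Resolving-if-δ-injective (landmarks E) injective
    where
      injective : ∀ u v → SameOn (landmarks E) u v → u ≡ v
      injective u v same with member u in u∈ | member v in v∈
      ... | nothing | nothing = separates u v u∈ v∈ (same _ (firstOf∈ E F.zero))
                                  (λ w w∈ → same w (∈-++⁺ʳ (map firstOf (allFin _)) w∈))
      ... | just k  | _       = member-determined E u v k u∈ same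
      ... | nothing | just k  = sym (member-determined E v u k v∈ (λ w w∈ → sym (same w w∈)))

  Unique-landmarks : ∀ E → Unique E → (∀ w → w ∈ E → member w ≡ nothing) → Unique (landmarks E)
  Unique-landmarks E uniq off = ++⁺ (map⁺ firstOf-injective (allFin⁺ _)) uniq disjoint
    where
      inner-path : ∀ {i i′ j j′} → inner i j ≡ inner i′ j′ → i ≡ i′
      inner-path refl = refl
      firstOf-injective : ∀ {k k′} → firstOf k ≡ firstOf k′ → k ≡ k′
      firstOf-injective eq = path-injective (FP.suc-injective (inner-path eq))
      disjoint : ∀ {v} → ¬ (v ∈ map firstOf (allFin _) × v ∈ E)
      disjoint (v∈ , v∈E) with ∈-map⁻ firstOf v∈
      ... | k , _ , refl with trans (sym (member-short k F.zero)) (off _ v∈E)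
      ...   | ()

  length-landmarks : ∀ E → length (landmarks E) ≡ suc (suc q) + length E
  length-landmarks E = trans (length-++ (map firstOf (allFin _)))
    (cong (_+ length E) (trans (length-map firstOf (allFin _)) (length-tabulate {A = Fin (suc (suc q))} (λ k → k))))

⊓[m+o]≡m⇒≡m : ∀ {m n o} → 1 ≤ o → n ⊓ (m + o) ≡ m → n ≡ m
⊓[m+o]≡m⇒≡m {m} {n} {o} 1≤o eq with ⊓-sel n (m + o)
... | inj₁ eq′ = trans (sym eq′) eq
... | inj₂ eq′ = ⊥-elim (<-irrefl (trans (sym eq) eq′) (m<m+n m 1≤o))

sum-squeeze : ∀ {a s c} → a < s → 1 ≤ c → s + c ≡ suc (suc a) → s ≡ suc a × c ≡ 1
sum-squeeze {a} {s} {c} a<s 1≤c s+c≡ = s≡ , +-cancelˡ-≡ s c 1 (trans s+c≡ (sym (trans (cong (_+ 1) s≡) (+-comm (suc a) 1))))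
  where
    s≡ : s ≡ suc a
    s≡ = ≤-antisym (≤-pred (≤-trans (subst (_≤ s + c) (+-comm s 1) (+-monoʳ-≤ s 1≤c)) (≤-reflexive s+c≡))) a<s

mins-coincide⇒b+c≡s+2 : ∀ {a b c s} → a < s → 1 ≤ c →
  suc (suc a) ≡ suc (suc b) ⊓ (s + c) → suc (suc a) ≡ b ⊓ (s + c + 2) → b + c ≡ s + 2
mins-coincide⇒b+c≡s+2 {a} {b} {c} {s} a<s 1≤c eq₁ eq₂ with ⊓-sel b (s + c + 2)
... | inj₂ eq = ⊥-elim (<-irrefl refl (≤-trans a<s (≤-trans (m≤m+n s c) (≤-reflexive (sym a≡s+c)))))
  where
    a≡s+c : a ≡ s + c
    a≡s+c = suc-injective (suc-injective (trans eq₂ (trans eq (+-comm (s + c) 2))))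
... | inj₁ eq with b≡2+a ← sym (trans eq₂ eq) | ⊓-sel (suc (suc b)) (s + c)
...   | inj₁ eq′ = ⊥-elim (m≢1+n+m (suc (suc a)) {1} (trans eq₁ (trans eq′ (cong (suc ∘ suc) b≡2+a))))
...   | inj₂ eq′ with sum-squeeze a<s 1≤c (sym (trans eq₁ eq′))
...     | refl , refl rewrite b≡2+a = cong suc (sym (+-suc a 1))

mins-determine-mixed : ∀ {b b′ Y Y′} → b + Y ≡ b′ + Y′ → suc (suc b) ⊓ Y ≡ suc (suc b′) ⊓ Y′ →
                       b′ ⊓ (Y′ + 2) ≡ Y′ + 2 → b ≡ b′ ⊓ (Y′ + 2) → b ≡ b′
mins-determine-mixed {b} {b′} {Y} {Y′} sum≡ eq₁ eq′ b≡ = +-cancelʳ-≡ Y b b′ (trans sum≡ (cong (b′ +_) (sym Y≡Y′)))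
  where
    b≡Y′+2 : b ≡ suc (suc Y′)
    b≡Y′+2 = trans b≡ (trans eq′ (+-comm Y′ 2))
    Y′≤b′+2 : Y′ ≤ suc (suc b′)
    Y′≤b′+2 = ≤-trans (m≤m+n Y′ 2) (≤-trans (subst (_≤ b′) eq′ (m⊓n≤m b′ (Y′ + 2))) (m≤n+m b′ 2))
    rhs≡Y′ : suc (suc b′) ⊓ Y′ ≡ Y′
    rhs≡Y′ = m≥n⇒m⊓n≡n Y′≤b′+2
    Y≡Y′ : Y ≡ Y′
    Y≡Y′ with ⊓-sel (suc (suc b)) Y
    ... | inj₂ eq = trans (sym eq) (trans eq₁ rhs≡Y′)
    ... | inj₁ eq = ⊥-elim (m≢1+n+m Y′ {3} (sym (trans (sym (trans eq (cong (suc ∘ suc) b≡Y′+2))) (trans eq₁ rhs≡Y′))))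

mins-determine : ∀ {b b′ Y Y′} → b + Y ≡ b′ + Y′ → suc (suc b) ⊓ Y ≡ suc (suc b′) ⊓ Y′ →
                 b ⊓ (Y + 2) ≡ b′ ⊓ (Y′ + 2) → b ≡ b′
mins-determine {b} {b′} {Y} {Y′} sum≡ eq₁ eq₂ with ⊓-sel b (Y + 2) | ⊓-sel b′ (Y′ + 2)
... | inj₁ eq | inj₁ eq′ = trans (sym eq) (trans eq₂ eq′)
... | inj₂ eq | inj₂ eq′ = +-cancelʳ-≡ Y b b′ (trans sum≡ (cong (b′ +_) (sym Y≡Y′)))
  where
    Y≡Y′ : Y ≡ Y′
    Y≡Y′ = +-cancelʳ-≡ 2 Y Y′ (trans (sym eq) (trans eq₂ eq′))
... | inj₁ eq | inj₂ eq′ = mins-determine-mixed sum≡ eq₁ eq′ (trans (sym eq) eq₂)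
... | inj₂ eq | inj₁ eq′ = sym (mins-determine-mixed (sym sum≡) (sym eq₁) eq (trans (sym eq′) (sym eq₂)))

HasResolvingSet : (n t e k : ℕ) → Set
HasResolvingSet n t e k = ∃[ W ] (Unique W × length W ≡ k × ThetaDistance.Resolving n t e W)

module AllButOneShortPath (n t e : ℕ) where
  open ThetaDistance n t e public

  pattern free j = short F.zero j

  member : Vertex → Maybe (Fin (suc (suc n)))
  member (short (F.suc k) _) = just k
  member _                   = nothing

  member-just : ∀ x k → member x ≡ just k → ∃ λ j → x ≡ short (F.suc k) j
  member-just (short (F.suc k) j) .k refl = j , refl

  open LandmarkFamily n t e n F.suc FP.suc-injective member member-just (λ _ _ → refl) public

  g : Vertex
  g = firstOf F.zero

  dist-free-g : ∀ j → dist (free j) g ≡ suc (suc (toℕ j))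
  dist-free-g j = dist-short-first F.zero (F.suc F.zero) j (λ ())

  Separated : Vertex → Vertex → Vertex → Set
  Separated z u v = dist u g ≡ dist v g → dist u z ≡ dist v z → u ≡ v

  separated-sym : ∀ {u v} z → Separated z u v → Separated z v u
  separated-sym z sep eq-g eq-z = sym (sep (sym eq-g) (sym eq-z))

  record Separation (z : Vertex) : Set where
    field
      c₁-c₂     : Separated z c₁ c₂
      c₂-free   : ∀ j → Separated z c₂ (free j)
      c₂-long   : ∀ j → Separated z c₂ (long j)
      free-long : ∀ j j′ → Separated z (free j) (long j′)
      long-long : ∀ j j′ → Separated z (long j) (long j′)

  c₁-free : ∀ z j → Separated z c₁ (free j)
  c₁-free z j eq-g _ with trans eq-g (dist-free-g j)
  ... | ()

  c₁-long : ∀ z j → Separated z c₁ (long j)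
  c₁-long z j eq-g _ with ⊓[m+o]≡m⇒≡m {1} {o = t + up j} (≤-trans (1≤up j) (m≤n+m (up j) t)) (sym (trans eq-g (dist-long-first (F.suc F.zero) j)))
  ... | ()

  free-free : ∀ z j j′ → Separated z (free j) (free j′)
  free-free z j j′ eq-g _ = cong free (FP.toℕ-injective
    (suc-injective (suc-injective (trans (sym (dist-free-g j)) (trans eq-g (dist-free-g j′))))))

  separated : ∀ z → Separation z → ∀ u v → member u ≡ nothing → member v ≡ nothing → Separated z u v
  separated z sep c₁         c₁         _ _ _ _ = refl
  separated z sep c₁         c₂         _ _ = Separation.c₁-c₂ sep
  separated z sep c₁         (long j)   _ _ = c₁-long z j
  separated z sep c₁         (free j)   _ _ = c₁-free z j
  separated z sep c₂         c₁         _ _ = separated-sym z (Separation.c₁-c₂ sep)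
  separated z sep c₂         c₂         _ _ _ _ = refl
  separated z sep c₂         (long j)   _ _ = Separation.c₂-long sep j
  separated z sep c₂         (free j)   _ _ = Separation.c₂-free sep j
  separated z sep (long j)   c₁         _ _ = separated-sym z (c₁-long z j)
  separated z sep (long j)   c₂         _ _ = separated-sym z (Separation.c₂-long sep j)
  separated z sep (long j)   (long j′)  _ _ = Separation.long-long sep j j′
  separated z sep (long j)   (free j′)  _ _ = separated-sym z (Separation.free-long sep j′ j)
  separated z sep (free j)   c₁         _ _ = separated-sym z (c₁-free z j)
  separated z sep (free j)   c₂         _ _ = separated-sym z (Separation.c₂-free sep j)
  separated z sep (free j)   (long j′)  _ _ = Separation.free-long sep j j′
  separated z sep (free j)   (free j′)  _ _ = free-free z j j′
  separated z sep (short (F.suc _) _) _ () _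
  separated z sep c₁         (short (F.suc _) _) _ ()
  separated z sep c₂         (short (F.suc _) _) _ ()
  separated z sep (long _)   (short (F.suc _) _) _ ()
  separated z sep (free _)   (short (F.suc _) _) _ ()

  separation⇒resolvingSet : ∀ z → member z ≡ nothing → Separation z → HasResolvingSet n t e (suc (suc (suc n)))
  separation⇒resolvingSet z z-off sep =
    landmarks (z ∷ []) ,
    Unique-landmarks (z ∷ []) (All.[] ∷ []) (λ { _ (here refl) → z-off }) ,
    trans (length-landmarks (z ∷ [])) (+-comm (suc (suc n)) 1) ,
    Resolving-landmarks (z ∷ []) (λ u v u-off v-off eq-g same → separated z sep u v u-off v-off eq-g (same z (here refl)))

  long-sum : ∀ j → toℕ j + (s₁ + up j) ≡ s₁ + s₂
  long-sum j = trans (sym (+-assoc (toℕ j) s₁ (up j)))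
    (trans (cong (_+ up j) (+-comm (toℕ j) s₁)) (trans (+-assoc s₁ (toℕ j) (up j)) (cong (s₁ +_) (j+up≡s₂ j))))

  dist-c₂-g : dist c₂ g ≡ s₁
  dist-c₂-g = dist-c₂-first (F.suc F.zero)

  dist-long-g : ∀ j → dist (long j) g ≡ suc (suc (toℕ j)) ⊓ (s₁ + up j)
  dist-long-g = dist-long-first (F.suc F.zero)

  -- When s₂ ≠ s₁ + 2, the first vertex of the long path completes the resolving set.
  separation-long₀ : e ≢ 1 → Separation (long F.zero)
  separation-long₀ e≢1 = record
    { c₁-c₂     = λ _ eq-z → case trans eq-z dist-c₂-long₀ of λ ()
    ; c₂-free   = c₂-free
    ; c₂-long   = c₂-long
    ; free-long = free-long
    ; long-long = λ j j′ eq-g eq-z → cong long (FP.toℕ-injective (mins-determine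
        (trans (long-sum j) (sym (long-sum j′)))
        (trans (sym (dist-long-g j)) (trans eq-g (dist-long-g j′)))
        (trans (sym (dist-long-long₀ j)) (trans eq-z (dist-long-long₀ j′)))))
    }
    where
      z = long F.zero
      s₁<c₂z : s₁ < s₂ ⊓ suc D
      s₁<c₂z = ⊓-glb s₁<s₂ (n≤1+n (suc s₁))

      c₂-free : ∀ j → Separated z c₂ (free j)
      c₂-free j eq-g eq-z = ⊥-elim (<-irrefl (sym c₂z≡s₁) s₁<c₂z)
        where
          c₂z≡s₁ : s₂ ⊓ suc D ≡ s₁
          c₂z≡s₁ = trans (sym dist-c₂-long₀) (trans eq-z (trans (dist-short-long₀ F.zero j)
                     (sym (trans (sym dist-c₂-g) (trans eq-g (dist-free-g j))))))

      c₂-long : ∀ j → Separated z c₂ (long j)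
      c₂-long j eq-g eq-z = ⊥-elim (<-irrefl refl (begin-strict
        s₂ ⊓ suc D                         ≡⟨ trans (sym dist-c₂-long₀) (trans eq-z (dist-long-long₀ j)) ⟩
        toℕ j ⊓ (s₁ + up j + 2)            ≤⟨ m⊓n≤m _ _ ⟩
        toℕ j                              <⟨ m<n+m (toℕ j) (s≤s z≤n) ⟩
        suc (suc (toℕ j))                  ≡⟨ ⊓[m+o]≡m⇒≡m (1≤up j) (sym (trans (sym dist-c₂-g) (trans eq-g (dist-long-g j)))) ⟩
        s₁                                 <⟨ s₁<c₂z ⟩
        s₂ ⊓ suc D                         ∎))
        where open ≤-Reasoning

      free-long : ∀ j j′ → Separated z (free j) (long j′)
      free-long j j′ eq-g eq-z = ⊥-elim (e≢1 (+-cancelˡ-≡ t e 1 (suc-injective (suc-injective (begin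
        s₂                  ≡⟨ sym (j+up≡s₂ j′) ⟩
        toℕ j′ + up j′      ≡⟨ mins-coincide⇒b+c≡s+2 (FP.toℕ<n j) (1≤up j′)
                                 (trans (sym (dist-free-g j)) (trans eq-g (dist-long-g j′)))
                                 (trans (sym (dist-short-long₀ F.zero j)) (trans eq-z (dist-long-long₀ j′))) ⟩
        s₁ + 2              ≡⟨ cong suc (+-comm t 2) ⟩
        suc (suc (suc t))   ≡⟨ cong (suc ∘ suc) (+-comm 1 t) ⟩
        suc (suc (t + 1))   ∎)))))
        where open ≡-Reasoning

∣m-2∣<n : ∀ {m n} → m < n → 2 < n → ∣ m - 2 ∣ < n
∣m-2∣<n {m} m<n 2<n = ≤-<-trans (∣m-n∣≤m⊔n m 2) (⊔-lub m<n 2<n)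

∣m-2∣≤n : ∀ {m n} → 2 ≤ n → m ≤ n + 2 → ∣ m - 2 ∣ ≤ n
∣m-2∣≤n {0}           2≤n _   = 2≤n
∣m-2∣≤n {1}           2≤n _   = ≤-trans (n≤1+n 1) 2≤n
∣m-2∣≤n {suc (suc k)} {n} _ m≤ =
  subst (_≤ n) (sym (∣-∣-identityʳ k)) (≤-pred (≤-pred (subst (suc (suc k) ≤_) (+-comm n 2) m≤)))

long₂-separates-free-long : ∀ {a b c s} → a < s → 3 ≤ s → 1 ≤ c → b + c ≡ s + 2 →
  suc (suc a) ≡ suc (suc b) ⊓ (s + c) → (suc a + 3) ⊓ ((s ∸ a) + s) ≢ ∣ b - 2 ∣
long₂-separates-free-long {a} {b} {c} {s} a<s 3≤s 1≤c b+c≡ eq-g eq-z with ⊓-sel (suc (suc b)) (s + c)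
... | inj₁ eq = <-irrefl (sym eq-z) (⊓-glb (∣m-2∣<n (subst (_< suc a + 3) a≡b (m≤m+n (suc a) 3))
                                                   (≤-trans (s≤s (s≤s (s≤s z≤n))) (m≤n+m 3 (suc a))))
                                            (∣m-2∣<n (subst (_< (s ∸ a) + s) a≡b (≤-trans a<s (m≤n+m s (s ∸ a))))
                                                   (≤-trans 3≤s (m≤n+m s (s ∸ a)))))
  where
    a≡b : a ≡ b
    a≡b = suc-injective (suc-injective (trans eq-g eq))
... | inj₂ eq with sum-squeeze a<s 1≤c (sym (trans eq-g eq))
...   | refl , refl = m≢1+n+m a {1} (begin
  a                                          ≡⟨ sym (∣-∣-identityʳ a) ⟩
  ∣ suc (suc a) - 2 ∣                        ≡⟨ cong (λ x → ∣ x - 2 ∣) (sym b≡2+a) ⟩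
  ∣ b - 2 ∣                                  ≡⟨ sym eq-z ⟩
  (suc a + 3) ⊓ ((suc a ∸ a) + suc a)        ≡⟨ cong (λ d → (suc a + 3) ⊓ (d + suc a)) (m+n∸n≡m 1 a) ⟩
  (suc a + 3) ⊓ suc (suc a)                  ≡⟨ m≥n⇒m⊓n≡n (≤-trans (n≤1+n (suc (suc a))) (≤-trans (n≤1+n _) (≤-reflexive (sym (+-comm (suc a) 3))))) ⟩
  suc (suc a)                                ∎)
  where
    open ≡-Reasoning
    b≡2+a : b ≡ suc (suc a)
    b≡2+a = +-cancelʳ-≡ 1 b (suc (suc a)) (trans b+c≡ (cong suc (+-suc a 1)))

module _ {s : ℕ} (3≤s : 3 ≤ s) where

  private
    h0<h4 : ∀ c c′ → suc (suc 0) ⊓ (s + c) < suc (suc 4) ⊓ (s + c′)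
    h0<h4 c c′ = subst (_< _) (sym (m≤n⇒m⊓n≡m (≤-trans (n≤1+n 2) (≤-trans 3≤s (m≤m+n s c)))))
                   (⊓-glb (s≤s (s≤s (s≤s z≤n))) (≤-trans 3≤s (m≤m+n s c′)))

    h1<h3 : ∀ c c′ → 3 + c′ ≡ s + 2 → suc (suc 1) ⊓ (s + c) < suc (suc 3) ⊓ (s + c′)
    h1<h3 c c′ 3+c′≡ = subst (_< _) (sym (m≤n⇒m⊓n≡m (≤-trans 3≤s (m≤m+n s c))))
                         (⊓-glb (s≤s (s≤s (s≤s (s≤s z≤n)))) (+-mono-≤ 3≤s 1≤c′))
      where
        5≤3+c′ : 5 ≤ 3 + c′
        5≤3+c′ = ≤-trans (+-monoˡ-≤ 2 3≤s) (≤-reflexive (sym 3+c′≡))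
        1≤c′ : 1 ≤ c′
        1≤c′ = ≤-trans (s≤s z≤n) (≤-pred (≤-pred (≤-pred 5≤3+c′)))

  ∣-2∣-and-min-determine : ∀ b b′ {c c′} → b + c ≡ s + 2 → b′ + c′ ≡ s + 2 →
    suc (suc b) ⊓ (s + c) ≡ suc (suc b′) ⊓ (s + c′) → ∣ b - 2 ∣ ≡ ∣ b′ - 2 ∣ → b ≡ b′
  ∣-2∣-and-min-determine 0 0 _ _ _ _ = refl
  ∣-2∣-and-min-determine 1 1 _ _ _ _ = refl
  ∣-2∣-and-min-determine (suc (suc k)) (suc (suc k′)) _ _ _ eq-abs =
    cong (suc ∘ suc) (trans (sym (∣-∣-identityʳ k)) (trans eq-abs (∣-∣-identityʳ k′)))
  ∣-2∣-and-min-determine 0 (suc (suc k′)) {c} {c′} _ _ eq-h eq-abs with trans eq-abs (∣-∣-identityʳ k′)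
  ... | refl = ⊥-elim (<-irrefl eq-h (h0<h4 c c′))
  ∣-2∣-and-min-determine 1 (suc (suc k′)) {c} {c′} _ sum′ eq-h eq-abs with trans eq-abs (∣-∣-identityʳ k′)
  ... | refl = ⊥-elim (<-irrefl eq-h (h1<h3 c c′ sum′))
  ∣-2∣-and-min-determine (suc (suc k)) 0 {c} {c′} _ _ eq-h eq-abs with trans (sym eq-abs) (∣-∣-identityʳ k)
  ... | refl = ⊥-elim (<-irrefl (sym eq-h) (h0<h4 c′ c))
  ∣-2∣-and-min-determine (suc (suc k)) 1 {c} {c′} sum _ eq-h eq-abs with trans (sym eq-abs) (∣-∣-identityʳ k)
  ... | refl = ⊥-elim (<-irrefl (sym eq-h) (h1<h3 c′ c sum))
  ∣-2∣-and-min-determine 0 1 _ _ _ ()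
  ∣-2∣-and-min-determine 1 0 _ _ _ ()

-- When s₂ = s₁ + 2 and s₁ ≥ 3, the third vertex of the long path completes the resolving set.
module LongThirdVertex (n t′ : ℕ) where
  open AllButOneShortPath n (suc (suc t′)) 1 public

  z : Vertex
  z = long (F.suc (F.suc F.zero))

  s₂≡s₁+2 : s₂ ≡ s₁ + 2
  s₂≡s₁+2 = arrange t′
    where
      arrange : ∀ t → suc (suc (suc (suc t) + 1)) ≡ suc (suc (suc t)) + 2
      arrange = solve-∀

  3≤s₁ : 3 ≤ s₁
  3≤s₁ = s≤s (s≤s (s≤s z≤n))

  d₁z : d₁ z ≡ 3
  d₁z = m≤n⇒m⊓n≡m (≤-trans 3≤s₁ (≤-trans (n≤1+n s₁) (m≤n+m D (s₂ ∸ 2))))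

  d₂z : d₂ z ≡ s₁
  d₂z = trans (cong (_⊓ (3 + D)) (cong (suc ∘ suc) (+-comm t′ 1))) (m≤n⇒m⊓n≡m (≤-trans (n≤1+n s₁) (m≤n+m D 3)))

  dist-c₂-z : dist c₂ z ≡ s₁
  dist-c₂-z = dist≡ c₂ z s₁ (≤-trans (dist≤via₂ c₂ z) (≤-reflexive d₂z)) s₁≤via₁ s₁≤via₁ (≤-reflexive (sym d₂z))
    where
      s₁≤via₁ : s₁ ≤ via₁ c₂ z
      s₁≤via₁ = ≤-trans (n≤1+n s₁) (m≤m+n D (d₁ z))

  dist-free-z : ∀ j → dist (free j) z ≡ (suc (toℕ j) + 3) ⊓ ((s₁ ∸ toℕ j) + s₁)
  dist-free-z j = begin
    via₁ x z ⊓ (via₁ x z ⊓ via₂ x z) ≡⟨ sym (⊓-assoc (via₁ x z) _ _) ⟩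
    via₁ x z ⊓ via₁ x z ⊓ via₂ x z   ≡⟨ cong (_⊓ via₂ x z) (⊓-idem (via₁ x z)) ⟩
    via₁ x z ⊓ via₂ x z              ≡⟨ cong₂ _⊓_ (cong₂ _+_ (d₁-short F.zero j) d₁z) (cong₂ _+_ (d₂-short F.zero j) d₂z) ⟩
    (suc (toℕ j) + 3) ⊓ ((s₁ ∸ toℕ j) + s₁) ∎
    where
      open ≡-Reasoning
      x = free j

  dist-long-z : ∀ j → dist (long j) z ≡ ∣ toℕ j - 2 ∣
  dist-long-z j = dist≡ x z r (dist≤alongPath x z) (≤-reflexive (sym (alongPath-same F.zero j _))) r≤via₁ r≤via₂
    where
      ĵ = toℕ j
      x = long j
      r = ∣ ĵ - 2 ∣
      r≤s₁ : r ≤ s₁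
      r≤s₁ = ∣m-2∣≤n (≤-trans (n≤1+n 2) 3≤s₁) (≤-trans (<⇒≤ (FP.toℕ<n j)) (≤-reflexive s₂≡s₁+2))
      r≤via₁ : r ≤ via₁ x z
      r≤via₁ = subst (r ≤_) (sym (cong (d₁ x +_) d₁z))
        (⊓+-lower (suc ĵ) (up j + D) 3
          (<⇒≤ (∣m-2∣<n (m≤m+n (suc ĵ) 3) (≤-trans (s≤s (s≤s (s≤s z≤n))) (m≤n+m 3 (suc ĵ)))))
          (≤-trans r≤s₁ (≤-trans (n≤1+n s₁) (≤-trans (m≤n+m D (up j)) (m≤m+n (up j + D) 3)))))
      r≤via₂ : r ≤ via₂ x z
      r≤via₂ = subst (r ≤_) (sym (cong (d₂ x +_) d₂z))
        (⊓+-lower (up j) (suc ĵ + D) s₁ (≤-trans r≤s₁ (m≤n+m s₁ (up j))) (≤-trans r≤s₁ (m≤n+m s₁ (suc ĵ + D))))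

  2+j≡s₁ : ∀ j → dist c₂ g ≡ dist (long j) g → suc (suc (toℕ j)) ≡ s₁
  2+j≡s₁ j eq-g = ⊓[m+o]≡m⇒≡m (1≤up j) (sym (trans (sym dist-c₂-g) (trans eq-g (dist-long-g j))))

  separation-long₂ : Separation z
  separation-long₂ = record
    { c₁-c₂     = λ eq-g _ → case trans eq-g dist-c₂-g of λ ()
    ; c₂-free   = c₂-free
    ; c₂-long   = c₂-long
    ; free-long = free-long
    ; long-long = long-long
    }
    where
      c₂-free : ∀ j → Separated z c₂ (free j)
      c₂-free j eq-g eq-z = ⊥-elim (m≢1+n+m (suc (suc ĵ)) {1} (sym (begin
        suc (suc (suc (suc ĵ)))                               ≡⟨ sym (m≥n⇒m⊓n≡n (≤-reflexive (+-comm 3 (suc ĵ)))) ⟩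
        (suc ĵ + 3) ⊓ (2 + suc (suc ĵ))                       ≡⟨ cong (λ d → (suc ĵ + 3) ⊓ (d + suc (suc ĵ))) (sym (m+n∸n≡m 2 ĵ)) ⟩
        (suc ĵ + 3) ⊓ ((suc (suc ĵ) ∸ ĵ) + suc (suc ĵ))       ≡⟨ cong (λ s → (suc ĵ + 3) ⊓ ((s ∸ ĵ) + s)) (sym s₁≡2+j) ⟩
        (suc ĵ + 3) ⊓ ((s₁ ∸ ĵ) + s₁)                         ≡⟨ sym (dist-free-z j) ⟩
        dist (free j) z                                       ≡⟨ sym eq-z ⟩
        dist c₂ z                                             ≡⟨ trans dist-c₂-z s₁≡2+j ⟩
        suc (suc ĵ)                                           ∎)))
        where
          open ≡-Reasoning
          ĵ = toℕ j
          s₁≡2+j : s₁ ≡ suc (suc ĵ)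
          s₁≡2+j = trans (sym dist-c₂-g) (trans eq-g (dist-free-g j))

      c₂-long : ∀ j → Separated z c₂ (long j)
      c₂-long j eq-g eq-z = ⊥-elim (<-irrefl (trans (sym (dist-long-z j)) (trans (sym eq-z) dist-c₂-z))
        (∣m-2∣<n (subst (toℕ j <_) (2+j≡s₁ j eq-g) (m<n+m (toℕ j) (s≤s z≤n))) 3≤s₁))

      free-long : ∀ j j′ → Separated z (free j) (long j′)
      free-long j j′ eq-g eq-z = ⊥-elim (long₂-separates-free-long (FP.toℕ<n j) 3≤s₁ (1≤up j′)
        (trans (j+up≡s₂ j′) s₂≡s₁+2)
        (trans (sym (dist-free-g j)) (trans eq-g (dist-long-g j′)))
        (trans (sym (dist-free-z j)) (trans eq-z (dist-long-z j′))))

      long-long : ∀ j j′ → Separated z (long j) (long j′)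
      long-long j j′ eq-g eq-z = cong long (FP.toℕ-injective (∣-2∣-and-min-determine 3≤s₁ (toℕ j) (toℕ j′)
        (trans (j+up≡s₂ j) s₂≡s₁+2) (trans (j+up≡s₂ j′) s₂≡s₁+2)
        (trans (sym (dist-long-g j)) (trans eq-g (dist-long-g j′)))
        (trans (sym (dist-long-z j)) (trans eq-z (dist-long-z j′)))))

-- The cases s₁ = 1, s₂ = 3 and s₁ = 2, s₂ = 4

-- Θ(2^{m-1}, 4) for m ≥ 5: the first vertices of all short paths but two, the second vertex of
-- one of those two, and the third vertex of the long path.
module ShortTwoLongFour (n : ℕ) where
  open ThetaDistance (suc n) 1 1

  member : Vertex → Maybe (Fin (suc (suc n)))
  member (short (F.suc (F.suc k)) _) = just k
  member _                           = nothing

  member-just : ∀ x k → member x ≡ just k → ∃ λ j → x ≡ short (F.suc (F.suc k)) j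
  member-just (short (F.suc (F.suc k)) j) .k refl = j , refl

  open LandmarkFamily (suc n) 1 1 n (F.suc ∘ F.suc) (FP.suc-injective ∘ FP.suc-injective)
    member member-just (λ _ _ → refl)

  w z : Vertex
  w = short (F.suc F.zero) (F.suc F.zero)
  z = long (F.suc (F.suc F.zero))

  E : List Vertex
  E = w ∷ z ∷ []

  signature : Vertex → ℕ × ℕ × ℕ
  signature x = dist x (firstOf F.zero) , dist x w , dist x z

  decode : ℕ × ℕ × ℕ → Vertex
  decode (1 , 2 , 3) = c₁
  decode (2 , 1 , 2) = c₂
  decode (2 , 3 , 2) = long F.zero
  decode (3 , 4 , 1) = long (F.suc F.zero)
  decode (4 , 3 , 0) = long (F.suc (F.suc F.zero))
  decode (3 , 2 , 1) = long (F.suc (F.suc (F.suc F.zero)))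
  decode (2 , 3 , 4) = short F.zero F.zero
  decode (3 , 2 , 3) = short F.zero (F.suc F.zero)
  decode (2 , 1 , 4) = short (F.suc F.zero) F.zero
  decode (3 , 0 , 3) = short (F.suc F.zero) (F.suc F.zero)
  decode _           = c₁

  decode-signature : ∀ x → member x ≡ nothing → decode (signature x) ≡ x
  decode-signature c₁ _ = refl
  decode-signature c₂ _ = refl
  decode-signature (long F.zero) _ = refl
  decode-signature (long (F.suc F.zero)) _ = refl
  decode-signature (long (F.suc (F.suc F.zero))) _ = refl
  decode-signature (long (F.suc (F.suc (F.suc F.zero)))) _ = refl
  decode-signature (short F.zero F.zero) _ = refl
  decode-signature (short F.zero (F.suc F.zero)) _ = refl
  decode-signature (short (F.suc F.zero) F.zero) _ = refl
  decode-signature (short (F.suc F.zero) (F.suc F.zero)) _ = refl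
  decode-signature (short (F.suc (F.suc _)) _) ()

  resolvingSet : HasResolvingSet (suc n) 1 1 (suc (suc (suc (suc n))))
  resolvingSet =
    landmarks E ,
    Unique-landmarks E (((λ ()) All.∷ All.[]) ∷ All.[] ∷ []) (λ { _ (here refl) → refl ; _ (there (here refl)) → refl }) ,
    trans (length-landmarks E) (+-comm (suc (suc n)) 2) ,
    Resolving-landmarks E λ u v u-off v-off eq-g same → begin
      u                     ≡⟨ sym (decode-signature u u-off) ⟩
      decode (signature u)  ≡⟨ cong decode (cong₂ _,_ eq-g (cong₂ _,_ (same w (here refl)) (same z (there (here refl))))) ⟩
      decode (signature v)  ≡⟨ decode-signature v v-off ⟩
      v                     ∎
    where open ≡-Reasoning

-- Θ(1^{m-1}, 3): the first vertices of all short paths but one, the first vertex of the long path and c₁.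
module ShortOneLongThree (n : ℕ) where
  open AllButOneShortPath n 0 1

  E : List Vertex
  E = long F.zero ∷ c₁ ∷ []

  signature : Vertex → ℕ × ℕ × ℕ
  signature x = dist x g , dist x (long F.zero) , dist x c₁

  decode : ℕ × ℕ × ℕ → Vertex
  decode (1 , 1 , 0) = c₁
  decode (1 , 3 , 2) = c₂
  decode (2 , 0 , 1) = long F.zero
  decode (3 , 1 , 2) = long (F.suc F.zero)
  decode (2 , 2 , 3) = long (F.suc (F.suc F.zero))
  decode (2 , 2 , 1) = free F.zero
  decode _           = c₁

  decode-signature : ∀ x → member x ≡ nothing → decode (signature x) ≡ x
  decode-signature c₁ _ = refl
  decode-signature c₂ _ = refl
  decode-signature (long F.zero) _ = refl
  decode-signature (long (F.suc F.zero)) _ = refl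
  decode-signature (long (F.suc (F.suc F.zero))) _ = refl
  decode-signature (free F.zero) _ = refl
  decode-signature (short (F.suc _) _) ()

  resolvingSet : HasResolvingSet n 0 1 (suc (suc (suc (suc n))))
  resolvingSet =
    landmarks E ,
    Unique-landmarks E (((λ ()) All.∷ All.[]) ∷ All.[] ∷ []) (λ { _ (here refl) → refl ; _ (there (here refl)) → refl }) ,
    trans (length-landmarks E) (+-comm (suc (suc n)) 2) ,
    Resolving-landmarks E λ u v u-off v-off eq-g same → begin
      u                     ≡⟨ sym (decode-signature u u-off) ⟩
      decode (signature u)  ≡⟨ cong decode (cong₂ _,_ eq-g (cong₂ _,_ (same (long F.zero) (here refl)) (same c₁ (there (here refl))))) ⟩
      decode (signature v)  ≡⟨ decode-signature v v-off ⟩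
      v                     ∎
    where open ≡-Reasoning

module ShortOneLongThreeLowerBound (n : ℕ) where
  open ThetaDistance n 0 1
  open LowerBound n 0 1
  open DecMembership (FP._≟_ {suc (suc (suc n))}) using (_∈?_)

  -- Both vertices of each pair are at distance 2 from every landmark on a short path other than i₀,
  -- and at equal distance from b.
  twins : Fin (suc (suc (suc n))) → Vertex → Vertex × Vertex
  twins i₀ c₁                              = first i₀ , long F.zero
  twins i₀ c₂                              = first i₀ , long (F.suc (F.suc F.zero))
  twins i₀ (long F.zero)                   = first i₀ , long (F.suc (F.suc F.zero))
  twins i₀ (long (F.suc F.zero))           = long F.zero , long (F.suc (F.suc F.zero))
  twins i₀ (long (F.suc (F.suc F.zero)))   = first i₀ , long F.zero
  twins i₀ (short _ _)                     = long F.zero , long (F.suc (F.suc F.zero))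

  twins-distinct : ∀ i₀ b → proj₁ (twins i₀ b) ≢ proj₂ (twins i₀ b)
  twins-distinct i₀ c₁ ()
  twins-distinct i₀ c₂ ()
  twins-distinct i₀ (long F.zero) ()
  twins-distinct i₀ (long (F.suc F.zero)) ()
  twins-distinct i₀ (long (F.suc (F.suc F.zero))) ()
  twins-distinct i₀ (short _ _) ()

  twins-b : ∀ i₀ b → shortPathOf b ≡ nothing → dist (proj₁ (twins i₀ b)) b ≡ dist (proj₂ (twins i₀ b)) b
  twins-b i₀ c₁ _ = refl
  twins-b i₀ c₂ _ = refl
  twins-b i₀ (long F.zero) _ = refl
  twins-b i₀ (long (F.suc F.zero)) _ = refl
  twins-b i₀ (long (F.suc (F.suc F.zero))) _ = refl

  dist-first-short : ∀ {W i₀ k} → i₀ ∉ hitPaths W → short k F.zero ∈ W → dist (first i₀) (short k F.zero) ≡ 2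
  dist-first-short i₀∉ w∈ = dist-other-path _ F.zero _ F.zero (λ eq → unhit⇒≢ i₀∉ w∈ (sym (FP.suc-injective eq)))

  twins-short : ∀ {W i₀} → i₀ ∉ hitPaths W → ∀ b {k} → short k F.zero ∈ W →
                dist (proj₁ (twins i₀ b)) (short k F.zero) ≡ dist (proj₂ (twins i₀ b)) (short k F.zero)
  twins-short i₀∉ c₁                            w∈ = dist-first-short i₀∉ w∈
  twins-short i₀∉ c₂                            w∈ = dist-first-short i₀∉ w∈
  twins-short i₀∉ (long F.zero)                 w∈ = dist-first-short i₀∉ w∈
  twins-short i₀∉ (long (F.suc F.zero))         w∈ = refl
  twins-short i₀∉ (long (F.suc (F.suc F.zero))) w∈ = dist-first-short i₀∉ w∈
  twins-short i₀∉ (short _ _)                   w∈ = refl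

  ¬Resolving-allShort : ∀ W → (∀ w → w ∈ W → shortPathOf w ≢ nothing) → ¬ Resolving W
  ¬Resolving-allShort W onShort = ¬Resolving-if-confused W (long F.zero) (long (F.suc (F.suc F.zero))) (λ ()) same
    where
      same : ∀ w → w ∈ W → dist (long F.zero) w ≡ dist (long (F.suc (F.suc F.zero))) w
      same (short _ F.zero) _  = refl
      same c₁               w∈ = ⊥-elim (onShort _ w∈ refl)
      same c₂               w∈ = ⊥-elim (onShort _ w∈ refl)
      same (long _)         w∈ = ⊥-elim (onShort _ w∈ refl)

  ¬Resolving-one-offShort : ∀ W i₀ → i₀ ∉ hitPaths W → ∀ b →
    (∀ w → w ∈ W → shortPathOf w ≡ nothing → w ≡ b) → ¬ Resolving W
  ¬Resolving-one-offShort W i₀ i₀∉ b only =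
    ¬Resolving-if-confused W (proj₁ (twins i₀ b)) (proj₂ (twins i₀ b)) (twins-distinct i₀ b) same
    where
      Same : Vertex → Vertex → Set
      Same b w = dist (proj₁ (twins i₀ b)) w ≡ dist (proj₂ (twins i₀ b)) w
      offShort : ∀ w → w ∈ W → shortPathOf w ≡ nothing → Same b w
      offShort w w∈ off = subst (λ b → Same b w) (only w w∈ off) (twins-b i₀ w off)
      same : ∀ w → w ∈ W → Same b w
      same (short _ F.zero) w∈ = twins-short i₀∉ b w∈
      same c₁               w∈ = offShort _ w∈ refl
      same c₂               w∈ = offShort _ w∈ refl
      same (long _)         w∈ = offShort _ w∈ refl

  m≤resolving : ∀ W → Resolving W → suc (suc (suc (suc n))) ≤ length W
  m≤resolving W resolving with suc (suc (suc (suc n))) ≤? length W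
  ... | yes m≤ = m≤
  ... | no m≰  = ⊥-elim (few (≤-pred (≰⇒> m≰)))
    where
      offShort = nothings shortPathOf W
      count : length (hitPaths W) + length offShort ≡ length W
      count = length-justs+nothings shortPathOf W
      fewOffShort : ∀ {k} → suc (suc (suc n)) ≤ k + length (hitPaths W) → length W ≤ suc (suc (suc n)) → length offShort ≤ k
      fewOffShort {k} hit≥ few = +-cancelˡ-≤ (length (hitPaths W)) _ _
        (≤-trans (≤-reflexive count) (≤-trans few (≤-trans hit≥ (≤-reflexive (+-comm k _)))))
      allShort : offShort ≡ [] → ∀ w → w ∈ W → shortPathOf w ≢ nothing
      allShort none w w∈ off with ∈-nothings shortPathOf W w∈ off
      ... | w∈offShort rewrite none with w∈offShort
      ...   | ()
      only : ∀ {b} → offShort ≡ b ∷ [] → ∀ w → w ∈ W → shortPathOf w ≡ nothing → w ≡ b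
      only one w w∈ off with subst (w ∈_) one (∈-nothings shortPathOf W w∈ off)
      ... | here w≡b = w≡b
      few : length W ≤ suc (suc (suc n)) → ⊥
      few ≤m with all-or-counterexample (_∈? hitPaths W) (allFin _)
      ... | inj₁ allHit
        with nothings shortPathOf W in none | fewOffShort {0} (covering⇒length≥ _ (hitPaths W) (λ i → allHit i (∈-allFin i))) ≤m
      ...   | [] | _ = ¬Resolving-allShort W (allShort none) resolving
      few ≤m | inj₂ (i₀ , _ , i₀∉) with all-or-counterexample (λ i → (i FP.≟ i₀) ⊎-dec (i ∈? hitPaths W)) (allFin _)
      ...   | inj₂ (i₁ , _ , ¬covered) =
        ¬Resolving-two-unhit W i₀ i₁ (λ eq → ¬covered (inj₁ (sym eq))) i₀∉ (¬covered ∘ inj₂) resolving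
      ...   | inj₁ covered
        with nothings shortPathOf W in eq | fewOffShort {1} (covering-but-one _ (hitPaths W) i₀ (λ i → covered i (∈-allFin i))) ≤m
      ...     | []        | _       = ¬Resolving-allShort W (allShort eq) resolving
      ...     | b ∷ []    | _       = ¬Resolving-one-offShort W i₀ i₀∉ b (only eq) resolving
      ...     | _ ∷ _ ∷ _ | s≤s ()

module ShortTwoLongFourMinimal where
  open ThetaDistance 0 1 1

  inner-injective : ∀ {i j j′} → inner i j ≡ inner i j′ → j ≡ j′
  inner-injective refl = refl

  _≟ᵛ_ : (x y : Vertex) → Dec (x ≡ y)
  c₁ ≟ᵛ c₁ = yes refl
  c₁ ≟ᵛ c₂ = no λ ()
  c₁ ≟ᵛ inner _ _ = no λ ()
  c₂ ≟ᵛ c₁ = no λ ()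
  c₂ ≟ᵛ c₂ = yes refl
  c₂ ≟ᵛ inner _ _ = no λ ()
  inner _ _ ≟ᵛ c₁ = no λ ()
  inner _ _ ≟ᵛ c₂ = no λ ()
  inner i j ≟ᵛ inner k l with i FP.≟ k
  ... | no i≢k   = no λ { refl → i≢k refl }
  ... | yes refl = map′ (cong (inner i)) inner-injective (j FP.≟ l)

  vertices : List Vertex
  vertices = c₁ ∷ c₂ ∷ long F.zero ∷ long (F.suc F.zero) ∷ long (F.suc (F.suc F.zero)) ∷ long (F.suc (F.suc (F.suc F.zero)))
           ∷ short F.zero F.zero ∷ short F.zero (F.suc F.zero)
           ∷ short (F.suc F.zero) F.zero ∷ short (F.suc F.zero) (F.suc F.zero)
           ∷ short (F.suc (F.suc F.zero)) F.zero ∷ short (F.suc (F.suc F.zero)) (F.suc F.zero) ∷ []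

  ∈-vertices : ∀ x → x ∈ vertices
  ∈-vertices c₁                                           = here refl
  ∈-vertices c₂                                           = there (here refl)
  ∈-vertices (long F.zero)                                = there (there (here refl))
  ∈-vertices (long (F.suc F.zero))                        = there (there (there (here refl)))
  ∈-vertices (long (F.suc (F.suc F.zero)))                = there (there (there (there (here refl))))
  ∈-vertices (long (F.suc (F.suc (F.suc F.zero))))        = there (there (there (there (there (here refl)))))
  ∈-vertices (short F.zero F.zero)                        = there (there (there (there (there (there (here refl))))))
  ∈-vertices (short F.zero (F.suc F.zero))                = there (there (there (there (there (there (there (here refl)))))))
  ∈-vertices (short (F.suc F.zero) F.zero)                = there (there (there (there (there (there (there (there (here refl))))))))
  ∈-vertices (short (F.suc F.zero) (F.suc F.zero))        = there (there (there (there (there (there (there (there (there (here refl)))))))))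
  ∈-vertices (short (F.suc (F.suc F.zero)) F.zero)        = there (there (there (there (there (there (there (there (there (there (here refl))))))))))
  ∈-vertices (short (F.suc (F.suc F.zero)) (F.suc F.zero)) = there (there (there (there (there (there (there (there (there (there (there (here refl)))))))))))

  -- Every 3-set fails to separate one of these pairs; the order only affects checking time.
  candidates : List (Vertex × Vertex)
  candidates =
    (short F.zero F.zero , short (F.suc F.zero) F.zero)
    ∷ (short F.zero F.zero , short (F.suc (F.suc F.zero)) F.zero)
    ∷ (short (F.suc F.zero) F.zero , short (F.suc (F.suc F.zero)) F.zero)
    ∷ (long F.zero , short F.zero F.zero)
    ∷ (long F.zero , short (F.suc F.zero) F.zero)
    ∷ (long F.zero , short (F.suc (F.suc F.zero)) F.zero)
    ∷ (long (F.suc (F.suc (F.suc F.zero))) , short F.zero (F.suc F.zero))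
    ∷ (long (F.suc (F.suc (F.suc F.zero))) , short (F.suc F.zero) (F.suc F.zero))
    ∷ (long (F.suc (F.suc (F.suc F.zero))) , short (F.suc (F.suc F.zero)) (F.suc F.zero))
    ∷ (c₁ , long (F.suc (F.suc (F.suc F.zero))))
    ∷ (c₁ , short F.zero (F.suc F.zero))
    ∷ (c₁ , short (F.suc F.zero) (F.suc F.zero))
    ∷ (c₁ , short (F.suc (F.suc F.zero)) (F.suc F.zero))
    ∷ (c₂ , long F.zero)
    ∷ (c₂ , short F.zero F.zero)
    ∷ (c₂ , short (F.suc F.zero) F.zero)
    ∷ (c₂ , short (F.suc (F.suc F.zero)) F.zero)
    ∷ []

  confuses : List Vertex → Vertex × Vertex → Bool
  confuses W (u , v) = not (isYes (u ≟ᵛ v)) ∧ all (λ w → dist u w ≡ᵇ dist v w) W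

  confuses-sound : ∀ W u v → T (confuses W (u , v)) → u ≢ v × (∀ w → w ∈ W → dist u w ≡ dist v w)
  confuses-sound W u v confused with Equivalence.to T-∧ confused
  ... | u≢v , same = toWitnessFalse {a? = u ≟ᵛ v} u≢v ,
                      λ w w∈ → ≡ᵇ⇒≡ (dist u w) (dist v w) (All.lookup (all⁺ _ W same) w∈)

  -- Opaque, so that only the check below ever runs the exhaustive search.
  opaque
    confusedTriple : Vertex → Vertex → Vertex → Bool
    confusedTriple a b c = any (confuses (a ∷ b ∷ c ∷ [])) candidates

  opaque
    unfolding confusedTriple

    every-triple-confused : T (all (λ a → all (λ b → all (confusedTriple a b) vertices) vertices) vertices)
    every-triple-confused = tt

    confusedTriple⇒any : ∀ a b c → T (confusedTriple a b c) → T (any (confuses (a ∷ b ∷ c ∷ [])) candidates)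
    confusedTriple⇒any a b c confused = confused

  lookupᵀ : ∀ (p : Vertex → Bool) x → T (all p vertices) → T (p x)
  lookupᵀ p x all-p = All.lookup (all⁺ p vertices all-p) (∈-vertices x)

  ¬Resolving-triple : ∀ a b c → ¬ Resolving (a ∷ b ∷ c ∷ [])
  ¬Resolving-triple a b c = case satisfied (any⁻ (confuses W) candidates (confusedTriple⇒any a b c confused)) of λ where
      ((u , v) , confused) → let u≢v , same = confuses-sound W u v confused in ¬Resolving-if-confused W u v u≢v same
    where
      W = a ∷ b ∷ c ∷ []
      confused : T (confusedTriple a b c)
      confused = lookupᵀ (confusedTriple a b) c (lookupᵀ (λ b → all (confusedTriple a b) vertices) b
                   (lookupᵀ (λ a → all (λ b → all (confusedTriple a b) vertices) vertices) a every-triple-confused))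

  m≤resolving : ∀ W → Resolving W → 4 ≤ length W
  m≤resolving W resolving with 4 ≤? length W
  ... | yes 4≤ = 4≤
  ... | no 4≰  = ⊥-elim (few W (≤-pred (≰⇒> 4≰)) resolving)
    where
      few : ∀ W → length W ≤ 3 → ¬ Resolving W
      few []              _ = ¬Resolving-triple c₁ c₁ c₁ ∘ Resolving-⊆ λ ()
      few (a ∷ [])        _ = ¬Resolving-triple a a a ∘ Resolving-⊆ λ { (here refl) → here refl }
      few (a ∷ b ∷ [])    _ = ¬Resolving-triple a b b ∘ Resolving-⊆ λ { (here refl) → here refl ; (there w∈) → there (there w∈) }
      few (a ∷ b ∷ c ∷ []) _ = ¬Resolving-triple a b c
      few (_ ∷ _ ∷ _ ∷ _ ∷ _) (s≤s (s≤s (s≤s ())))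

  W : List Vertex
  W = c₁ ∷ c₂ ∷ first F.zero ∷ first (F.suc F.zero) ∷ []

  signature : Vertex → ℕ × ℕ × ℕ × ℕ
  signature x = dist x c₁ , dist x c₂ , dist x (first F.zero) , dist x (first (F.suc F.zero))

  decode : ℕ × ℕ × ℕ × ℕ → Vertex
  decode (0 , 3 , 1 , 1) = c₁
  decode (3 , 0 , 2 , 2) = c₂
  decode (1 , 4 , 2 , 2) = long F.zero
  decode (2 , 3 , 3 , 3) = long (F.suc F.zero)
  decode (3 , 2 , 4 , 4) = long (F.suc (F.suc F.zero))
  decode (4 , 1 , 3 , 3) = long (F.suc (F.suc (F.suc F.zero)))
  decode (1 , 2 , 0 , 2) = short F.zero F.zero
  decode (2 , 1 , 1 , 3) = short F.zero (F.suc F.zero)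
  decode (1 , 2 , 2 , 0) = short (F.suc F.zero) F.zero
  decode (2 , 1 , 3 , 1) = short (F.suc F.zero) (F.suc F.zero)
  decode (1 , 2 , 2 , 2) = short (F.suc (F.suc F.zero)) F.zero
  decode (2 , 1 , 3 , 3) = short (F.suc (F.suc F.zero)) (F.suc F.zero)
  decode _               = c₁

  decode-signature : ∀ x → decode (signature x) ≡ x
  decode-signature c₁ = refl
  decode-signature c₂ = refl
  decode-signature (long F.zero) = refl
  decode-signature (long (F.suc F.zero)) = refl
  decode-signature (long (F.suc (F.suc F.zero))) = refl
  decode-signature (long (F.suc (F.suc (F.suc F.zero)))) = refl
  decode-signature (short F.zero F.zero) = refl
  decode-signature (short F.zero (F.suc F.zero)) = refl
  decode-signature (short (F.suc F.zero) F.zero) = refl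
  decode-signature (short (F.suc F.zero) (F.suc F.zero)) = refl
  decode-signature (short (F.suc (F.suc F.zero)) F.zero) = refl
  decode-signature (short (F.suc (F.suc F.zero)) (F.suc F.zero)) = refl

  resolvingSet : HasResolvingSet 0 1 1 4
  resolvingSet = W , distinct , refl , Resolving-if-δ-injective W injective
    where
      distinct : Unique W
      distinct = ((λ ()) All.∷ (λ ()) All.∷ (λ ()) All.∷ All.[]) ∷ ((λ ()) All.∷ (λ ()) All.∷ All.[])
               ∷ ((λ ()) All.∷ All.[]) ∷ All.[] ∷ []
      injective : ∀ u v → (∀ w → w ∈ W → dist u w ≡ dist v w) → u ≡ v
      injective u v same = begin
        u                    ≡⟨ sym (decode-signature u) ⟩
        decode (signature u) ≡⟨ cong decode (cong₂ _,_ (same c₁ (here refl)) (cong₂ _,_ (same c₂ (there (here refl)))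
                                  (cong₂ _,_ (same _ (there (there (here refl)))) (same _ (there (there (there (here refl)))))))) ⟩
        decode (signature v) ≡⟨ decode-signature v ⟩
        v                    ∎
        where open ≡-Reasoning

Exceptional : (m s₁ s₂ : ℕ) → Set
Exceptional m s₁ s₂ = (s₁ ≡ 1 × s₂ ≡ 3) ⊎ (m ≡ 4 × s₁ ≡ 2 × s₂ ≡ 4)

resolvingSet-m∸1 : ∀ n t e → ¬ Exceptional (suc (suc (suc (suc n)))) (suc t) (suc (suc (t + e))) →
                   HasResolvingSet n t e (suc (suc (suc n)))
resolvingSet-m∸1 n t e ¬exc with e ≟ 1
... | no e≢1 = separation⇒resolvingSet (long F.zero) refl (separation-long₀ e≢1)
  where open AllButOneShortPath n t e
resolvingSet-m∸1 n zero .1 ¬exc | yes refl = ⊥-elim (¬exc (inj₁ (refl , refl)))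
resolvingSet-m∸1 zero (suc zero) .1 ¬exc | yes refl = ⊥-elim (¬exc (inj₂ (refl , refl , refl)))
resolvingSet-m∸1 (suc n) (suc zero) .1 _ | yes refl = ShortTwoLongFour.resolvingSet n
resolvingSet-m∸1 n (suc (suc t′)) .1 _ | yes refl = separation⇒resolvingSet z refl separation-long₂
  where open LongThirdVertex n t′

metricDim-exceptional : ∀ n t e → Exceptional (suc (suc (suc (suc n)))) (suc t) (suc (suc (t + e))) →
  ThetaMetricDim (suc (suc (suc (suc n)))) (suc t) (suc (suc (t + e))) (suc (suc (suc (suc n))))
metricDim-exceptional n .0 .1 (inj₁ (refl , refl)) =
  ShortOneLongThree.resolvingSet n , λ W _ → ShortOneLongThreeLowerBound.m≤resolving n W
metricDim-exceptional .0 .1 .1 (inj₂ (refl , refl , refl)) =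
  ShortTwoLongFourMinimal.resolvingSet , λ W _ → ShortTwoLongFourMinimal.m≤resolving W

metricDim-generic : ∀ n t e → ¬ Exceptional (suc (suc (suc (suc n)))) (suc t) (suc (suc (t + e))) →
  ThetaMetricDim (suc (suc (suc (suc n)))) (suc t) (suc (suc (t + e))) (suc (suc (suc n)))
metricDim-generic n t e ¬exc = resolvingSet-m∸1 n t e ¬exc , λ W _ → LowerBound.m∸1≤resolving n t e W

mainTheorem10 : (m s₁ s₂ : ℕ) → 4 ≤ m → 1 ≤ s₁ → s₁ < s₂ →
    (((s₁ ≡ 1 × s₂ ≡ 3) ⊎ (m ≡ 4 × s₁ ≡ 2 × s₂ ≡ 4)) → ThetaMetricDim m s₁ s₂ m) ×
    (¬ ((s₁ ≡ 1 × s₂ ≡ 3) ⊎ (m ≡ 4 × s₁ ≡ 2 × s₂ ≡ 4)) → ThetaMetricDim m s₁ s₂ (m ∸ 1))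
mainTheorem10 (suc (suc (suc (suc n)))) (suc t) (suc (suc s)) (s≤s (s≤s (s≤s (s≤s z≤n)))) (s≤s z≤n) (s≤s (s≤s t≤s))
  rewrite sym (m+[n∸m]≡n t≤s) = metricDim-exceptional n t (s ∸ t) , metricDim-generic n t (s ∸ t)
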